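{- Let $n$ be a positive integer and let $\phi^{\mathrm{den}}_n:\mathfrak{S}_{n-1}\times\{0,\dots,n-1\}\to\mathfrak{S}_n$ be the map defined in the context. Then for all $\sigma\in\mathfrak{S}_{n-1}$ and $0\leq c\leq n-1$, $$\mathsf{Exc}(\phi^{\mathrm{den}}_n(\sigma,c))=\begin{cases}\mathsf{Exc}(\sigma),& 0\leq c\leq\mathsf{exc}(\sigma),\\ \mathsf{Exc}(\sigma)\cup\{k_d\},&\text{otherwise,}\end{cases}\qquad \mathsf{den}(\phi^{\mathrm{den}}_n(\sigma,c))=\mathsf{den}(\sigma)+c,$$ where $d=c-\mathsf{exc}(\sigma)$ and $k_d$ is the $d$-th smallest non-excedance of $\sigma$.
   Context: Permutations are in one-line notation. A position $i$ of $\sigma$ is an excedance if $\sigma_i>i$, a non-excedance otherwise; $\mathsf{Exc}(\sigma)$ is the set of excedances, $\mathsf{exc}(\sigma)=|\mathsf{Exc}(\sigma)|$; letters at excedances are excedance-letters. $\mathsf{inv}(u)$ counts pairs $i<j$ with $u_i>u_j$. $\mathsf{den}(\sigma)=\sum_{i\in\mathsf{Exc}(\sigma)}i+\mathsf{inv}(\mathrm{EXCL}(\sigma))+\mathsf{inv}(\mathrm{NEXCL}(\sigma))$, with $\mathrm{EXCL}(\sigma)$ the subsequence of excedance-letters and $\mathrm{NEXCL}(\sigma)$ the subsequence of the other letters. The map $\phi^{\mathrm{den}}_n$: let $\sigma=\sigma_1\cdots\sigma_{n-1}\in\mathfrak{S}_{n-1}$, $0\le c\le n-1$, $s=\mathsf{exc}(\sigma)$,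 let $e_1<\dots<e_s$ be the excedance-letters of $\sigma$, and $k_1<\dots<k_t$ the non-excedances of $\sigma$; set $k_{t+1}=n$. The image $w=w_1\cdots w_n$ is defined as follows. Case $c=0$: $w=\sigma_1\cdots\sigma_{n-1}n$. Case $1\le c\le s$: let $d=s+1-c$. Let $e_{j_1}<\dots<e_{j_x}$ be the excedance-letters of $\sigma$ located at positions strictly less than $e_d$ and with value at least $e_d$ (so $e_{j_1}=e_d$), and set $e_{j_{x+1}}=n$. Let $y$ be the least index with $k_y\geq e_d$. Step 1: replace each letter $e_{j_i}$ by $e_{j_{i+1}}$ ($i=1,\dots,x$). Step 2: for $i=y+1,\dots,t+1$, put the letter $\sigma_{k_{i-1}}$ at position $k_i$. Step 3: put $e_d$ at position $k_y$. All other positions keep the letter of $\sigma$. Case $s+1\le c\le n-1$: let $d=c-s$. For $i=d+1,\dots,t+1$, put $\sigma_{k_{i-1}}$ at position $k_i$; put $n$ at position $k_d$; all other positions keep the letter of $\sigma$. -}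

module Defs where

open import Data.Nat using (ℕ; zero; suc; _+_; _∸_; _<ᵇ_; _≡ᵇ_; _≤ᵇ_)
open import Data.Bool using (Bool; true; false; if_then_else_; _∧_; not)
open import Data.List using (List; []; _∷_; _++_; [_]; map; upTo; filterᵇ; dropWhileᵇ; length; zip; foldr)
open import Data.Nat.ListAction using (sum)
open import Data.Product using (_×_; _,_)
open import Data.List.Relation.Binary.Permutation.Propositional using (_↭_)

-- 1-based lookup in one-line notation (0 outside the range)
nth : List ℕ → ℕ → ℕ
nth []       _             = 0
nth (x ∷ xs) zero          = 0
nth (x ∷ xs) (suc zero)    = x
nth (x ∷ xs) (suc (suc i)) = nth xs (suc i)

positions : ℕ → List ℕ
positions m = map suc (upTo m)

IsPerm : ℕ → List ℕ → Set
IsPerm m σ = σ ↭ positions m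

isExc : List ℕ → ℕ → Bool
isExc σ i = i <ᵇ nth σ i

-- Exc(σ) (increasing list of excedance positions) and non-excedances k₁<⋯<k_t
Exc : List ℕ → List ℕ
Exc σ = filterᵇ (isExc σ) (positions (length σ))

NonExc : List ℕ → List ℕ
NonExc σ = filterᵇ (λ i → not (isExc σ i)) (positions (length σ))

exc : List ℕ → ℕ
exc σ = length (Exc σ)

EXCL : List ℕ → List ℕ
EXCL σ = map (nth σ) (Exc σ)

NEXCL : List ℕ → List ℕ
NEXCL σ = map (nth σ) (NonExc σ)

inv : List ℕ → ℕ
inv []       = 0
inv (x ∷ xs) = length (filterᵇ (λ y → y <ᵇ x) xs) + inv xs

den : List ℕ → ℕ
den σ = sum (Exc σ) + inv (EXCL σ) + inv (NEXCL σ)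

insert : ℕ → List ℕ → List ℕ
insert x []       = x ∷ []
insert x (y ∷ ys) = if x ≤ᵇ y then x ∷ y ∷ ys else y ∷ insert x ys

isort : List ℕ → List ℕ
isort = foldr insert []

setAt : ℕ → ℕ → List ℕ → List ℕ
setAt p v []                = []
setAt zero v (x ∷ xs)       = x ∷ xs
setAt (suc zero) v (x ∷ xs) = v ∷ xs
setAt (suc (suc p)) v (x ∷ xs) = x ∷ setAt (suc p) v xs

applyUpdates : List (ℕ × ℕ) → List ℕ → List ℕ
applyUpdates []              w = w
applyUpdates ((p , v) ∷ us) w = applyUpdates us (setAt p v w)

tl : List ℕ → List ℕ
tl []       = []
tl (_ ∷ xs) = xs

dropN : ℕ → List ℕ → List ℕ
dropN zero    xs       = xs
dropN (suc m) []       = []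
dropN (suc m) (_ ∷ xs) = dropN m xs

nextIn : List ℕ → ℕ → ℕ
nextIn []           v = v
nextIn (a ∷ [])     v = v
nextIn (a ∷ b ∷ rs) v = if v ≡ᵇ a then b else nextIn (b ∷ rs) v

-- given the suffix k_y, k_{y+1}, …, k_{t+1}, the updates
-- "put σ_{k_{i-1}} at position k_i" for i = y+1, …, t+1
shiftUpdates : List ℕ → List ℕ → List (ℕ × ℕ)
shiftUpdates σ suffix = zip (tl suffix) (map (nth σ) suffix)

phiDen : ℕ → List ℕ → ℕ → List ℕ
phiDen n σ zero = σ ++ [ n ]
phiDen n σ (suc c') =
  if c ≤ᵇ s then case1 else case2
  where
  c  = suc c'
  s  = exc σ
  ks = NonExc σ ++ [ n ]
  es = isort (EXCL σ)
  d₁ = (s + 1) ∸ c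
  ed = nth es d₁
  J  = isort (map (nth σ) (filterᵇ (λ p → (p <ᵇ ed) ∧ (ed ≤ᵇ nth σ p)) (Exc σ)))
  Jn = J ++ [ n ]
  step1 = map (nextIn Jn) σ ++ [ n ]
  sfx₁ = dropWhileᵇ (λ k → k <ᵇ ed) ks
  ky   = nth sfx₁ 1
  case1 = applyUpdates ((ky , ed) ∷ shiftUpdates σ sfx₁) step1
  d₂ = c ∸ s
  sfx₂ = dropN (d₂ ∸ 1) ks
  kd   = nth sfx₂ 1
  case2 = applyUpdates ((kd , n) ∷ shiftUpdates σ sfx₂) (σ ++ [ n ])

{-# OPTIONS --safe #-}
-- For c > exc σ, φ writes n at k_d and moves the later non-excedance letters one step along
-- the non-excedances, where they remain non-excedances. So k_d is the one new excedance, the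
-- excedance letters gain the maximal letter n just before the excedances after k_d, and the
-- non-excedance letters keep their order; den grows by k_d plus the number of excedances after
-- k_d, which is c because the k_d - 1 earlier positions are the remaining excedances and d - 1
-- non-excedances.
--
-- For c ≤ exc σ, step 1 raises each chain letter to the next one. This keeps every excedance,
-- is increasing on the letters at excedances left of e_d (so their inversions are unchanged),
-- and makes exactly one chain letter jump over each excedance letter at a position ≥ e_d.
-- Steps 2 and 3 keep the non-excedances and put e_d among the non-excedance letters at
-- positions ≥ e_d, creating one inversion per such letter below e_d. Since σ is a bijection,
-- those letters are as many as the positions < e_d carrying a letter ≥ e_d; together with the
-- excedances at positions ≥ e_d they count the excedance letters ≥ e_d, and there are exactly c
-- of them because e_d is the (exc σ + 1 - c)-th smallest.

module Submission where

open import Defs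
open import Data.Bool using (true; false; not; _∧_)
open import Data.List using (List; []; _∷_; _++_; [_]; map; length; filter; filterᵇ; dropWhile; dropWhileᵇ; take; applyUpTo; zip)
open import Data.List.Properties using (length-++; map-++; ++-assoc; ++-identityʳ; map-cong-local; filter-++; filter-accept; filter-reject; filter-all; filter-none; ∷-injective; map-∘; length-map)
open import Data.List.Membership.Propositional using (_∈_; _∉_)
open import Data.List.Membership.Propositional.Properties using (∈-filter⁻; ∈-filter⁺; ∈-map⁻; ∈-map⁺; ∈-++⁺ˡ; ∈-++⁺ʳ; ∈-++⁻)
open import Data.List.Relation.Unary.Any using (here; there)
open import Data.List.Relation.Unary.All as All using (All; []; _∷_)
open import Data.List.Relation.Unary.AllPairs as AllPairs using (AllPairs; []; _∷_)
import Data.List.Relation.Unary.AllPairs.Properties as AllPairs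
import Data.List.Relation.Unary.All.Properties as All
open import Data.List.Relation.Unary.Unique.Propositional using (Unique)
open import Data.List.Relation.Binary.Permutation.Propositional using (_↭_; ↭-sym; ↭-trans; ↭-refl; ↭-prep; ↭-swap; ↭⇒↭ₛ)
open import Data.List.Relation.Binary.Permutation.Propositional.Properties using (↭-length; ∈-resp-↭; All-resp-↭; filter-↭; shift)
open import Data.Nat using (ℕ; zero; suc; _+_; _∸_; _≤_; _<_; _≤ᵇ_; _<ᵇ_; _≡ᵇ_; z≤n; s≤s; s≤s⁻¹; z<s)
open import Data.Nat.Properties
open import Data.Nat.ListAction using (sum)
open import Data.Nat.ListAction.Properties using (sum-↭)
open import Data.Nat.Tactic.RingSolver using (solve-∀)
open import Data.Product using (_×_; _,_; proj₁; proj₂; ∃-syntax)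
open import Data.Sum using (_⊎_; inj₁; inj₂)
open import Level using (0ℓ)
open import Function using (_∘_; _⇔_; mk⇔; Equivalence)
open import Function.Related.TypeIsomorphisms using (¬-cong-⇔)
open import Relation.Binary.PropositionalEquality hiding ([_]; J)
open import Data.List.Relation.Binary.Permutation.Setoid.Properties (setoid ℕ) using (Unique-resp-↭)
open import Relation.Binary.Definitions using (tri<; tri≈; tri>)
open import Relation.Nullary using (¬_; yes; no; does; contradiction; ofʸ; ofⁿ; _⊎-dec_; _×-dec_)
open import Data.List.Membership.DecPropositional _≟_ using (_∈?_)
open import Relation.Unary using (Pred; Decidable; ∁)
open import Relation.Unary.Properties using (∁?)

-- The definitions test with Booleans; since `does (m <? n)` reduces to `m <ᵇ n`, these
-- lemmas let the library's lemmas about `filter` and `dropWhile` with decidable predicates apply.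

filterᵇ-does : {A : Set} {P : Pred A 0ℓ} (P? : Decidable P) (xs : List A) → filterᵇ (does ∘ P?) xs ≡ filter P? xs
filterᵇ-does P? [] = refl
filterᵇ-does P? (x ∷ xs) with does (P? x)
... | true  = cong (x ∷_) (filterᵇ-does P? xs)
... | false = filterᵇ-does P? xs

dropWhileᵇ-does : {A : Set} {P : Pred A 0ℓ} (P? : Decidable P) (xs : List A) → dropWhileᵇ (does ∘ P?) xs ≡ dropWhile P? xs
dropWhileᵇ-does P? [] = refl
dropWhileᵇ-does P? (x ∷ xs) with does (P? x)
... | true  = dropWhileᵇ-does P? xs
... | false = refl

filter-cong-local : {A : Set} {P Q : Pred A 0ℓ} {xs : List A} (P? : Decidable P) (Q? : Decidable Q) →
                    (∀ {x} → x ∈ xs → P x ⇔ Q x) → filter P? xs ≡ filter Q? xs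
filter-cong-local {xs = []} P? Q? P⇔Q = refl
filter-cong-local {xs = x ∷ xs} P? Q? P⇔Q with P? x | Q? x
... | yes _  | yes _  = cong (x ∷_) (filter-cong-local P? Q? (P⇔Q ∘ there))
... | no _   | no _   = filter-cong-local P? Q? (P⇔Q ∘ there)
... | yes px | no ¬qx = contradiction (Equivalence.to (P⇔Q (here refl)) px) ¬qx
... | no ¬px | yes qx = contradiction (Equivalence.from (P⇔Q (here refl)) qx) ¬px

filter-map : {A B : Set} {P : Pred A 0ℓ} (P? : Decidable P) (f : B → A) (xs : List B) → filter P? (map f xs) ≡ map f (filter (P? ∘ f) xs)
filter-map P? f [] = refl
filter-map P? f (x ∷ xs) with does (P? (f x))
... | true  = cong (f x ∷_) (filter-map P? f xs)
... | false = filter-map P? f xs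

count : {A : Set} {P : Pred A 0ℓ} → Decidable P → List A → ℕ
count P? xs = length (filter P? xs)

module _ {A : Set} {P : Pred A 0ℓ} (P? : Decidable P) where

  count-++ : ∀ xs ys → count P? (xs ++ ys) ≡ count P? xs + count P? ys
  count-++ xs ys = trans (cong length (filter-++ P? xs ys)) (length-++ (filter P? xs))

  count-↭ : {xs ys : List A} → xs ↭ ys → count P? xs ≡ count P? ys
  count-↭ p = ↭-length (filter-↭ P? p)

  count-all : {xs : List A} → All P xs → count P? xs ≡ length xs
  count-all ps = cong length (filter-all P? ps)

  count-none : {xs : List A} → All (∁ P) xs → count P? xs ≡ 0
  count-none ¬ps = cong length (filter-none P? ¬ps)

  count-complement : ∀ xs → count P? xs + count (∁? P?) xs ≡ length xs
  count-complement [] = refl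
  count-complement (x ∷ xs) with does (P? x)
  ... | true  = cong suc (count-complement xs)
  ... | false = trans (+-suc _ _) (cong suc (count-complement xs))

  count-partition : {Q : Pred A 0ℓ} (Q? : Decidable Q) (xs : List A) →
                    count P? xs ≡ count P? (filter Q? xs) + count P? (filter (∁? Q?) xs)
  count-partition Q? [] = refl
  count-partition Q? (x ∷ xs) with does (Q? x)
  ... | true  with does (P? x)
  ...   | true  = cong suc (count-partition Q? xs)
  ...   | false = count-partition Q? xs
  count-partition Q? (x ∷ xs) | false with does (P? x)
  ...   | true  = trans (cong suc (count-partition Q? xs)) (sym (+-suc _ _))
  ...   | false = count-partition Q? xs

count-map : {A B : Set} {P : Pred A 0ℓ} (P? : Decidable P) (f : B → A) (xs : List B) → count P? (map f xs) ≡ count (P? ∘ f) xs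
count-map P? f [] = refl
count-map P? f (x ∷ xs) with does (P? (f x))
... | true  = cong suc (count-map P? f xs)
... | false = count-map P? f xs

count-cong-local : {A : Set} {P Q : Pred A 0ℓ} {xs : List A} (P? : Decidable P) (Q? : Decidable Q) →
                   (∀ {x} → x ∈ xs → P x ⇔ Q x) → count P? xs ≡ count Q? xs
count-cong-local P? Q? P⇔Q = cong length (filter-cong-local P? Q? P⇔Q)

dropWhile-++ : {P : Pred ℕ 0ℓ} (P? : Decidable P) → ∀ {xs} ys → All P xs → dropWhile P? (xs ++ ys) ≡ dropWhile P? ys
dropWhile-++ P? ys []                 = refl
dropWhile-++ P? ys (_∷_ {x} px pxs) with P? x
... | yes _  = dropWhile-++ P? ys pxs
... | no ¬px = contradiction px ¬px

dropWhile-none : {P : Pred ℕ 0ℓ} (P? : Decidable P) → ∀ {ys} → All (∁ P) ys → dropWhile P? ys ≡ ys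
dropWhile-none P? []                  = refl
dropWhile-none P? (_∷_ {y} ¬py _) with P? y
... | yes py = contradiction py ¬py
... | no _   = refl

dropN-++ : ∀ (xs ys : List ℕ) → dropN (length xs) (xs ++ ys) ≡ ys
dropN-++ []       ys = refl
dropN-++ (x ∷ xs) ys = dropN-++ xs ys

-- Positions

range : ℕ → ℕ → List ℕ
range a zero    = []
range a (suc m) = a ∷ range (suc a) m

length-range : ∀ a m → length (range a m) ≡ m
length-range a zero    = refl
length-range a (suc m) = cong suc (length-range (suc a) m)

range-++ : ∀ a m k → range a (m + k) ≡ range a m ++ range (a + m) k
range-++ a zero    k = cong (λ b → range b k) (sym (+-identityʳ a))
range-++ a (suc m) k = cong (a ∷_) (trans (range-++ (suc a) m k) (cong (λ b → range (suc a) m ++ range b k) (sym (+-suc a m))))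

range-∷ʳ : ∀ a m → range a (suc m) ≡ range a m ++ [ a + m ]
range-∷ʳ a m = trans (cong (range a) (+-comm 1 m)) (range-++ a m 1)

∈-range⁻ : ∀ {x} a m → x ∈ range a m → a ≤ x × x < a + m
∈-range⁻ a (suc m) (here refl) = ≤-refl , m<m+n a z<s
∈-range⁻ {x} a (suc m) (there x∈) with ∈-range⁻ (suc a) m x∈
... | a<x , x<a+m = <⇒≤ a<x , subst (x <_) (sym (+-suc a m)) x<a+m

range-split : ∀ L t → 1 ≤ t → t ≤ suc L → range 1 L ≡ range 1 (t ∸ 1) ++ range t (suc L ∸ t)
range-split L (suc t) _ (s≤s t≤L) = trans (cong (range 1) (sym (m+[n∸m]≡n t≤L))) (range-++ 1 t (L ∸ t))

range-increasing : ∀ a m → AllPairs _<_ (range a m)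
range-increasing a zero    = []
range-increasing a (suc m) = All.tabulate (proj₁ ∘ ∈-range⁻ (suc a) m) ∷ range-increasing (suc a) m

map-suc-applyUpTo : ∀ (f : ℕ → ℕ) a m → (∀ i → f i ≡ a + i) → map suc (applyUpTo f m) ≡ range (suc a) m
map-suc-applyUpTo f a zero    f≗a+ = refl
map-suc-applyUpTo f a (suc m) f≗a+ =
  cong₂ _∷_ (cong suc (trans (f≗a+ 0) (+-identityʳ a)))
            (map-suc-applyUpTo (f ∘ suc) (suc a) m (λ i → trans (f≗a+ (suc i)) (+-suc a i)))

positions≡range : ∀ m → positions m ≡ range 1 m
positions≡range m = map-suc-applyUpTo (λ i → i) 0 m (λ _ → refl)

nth-∈ : ∀ xs {i} → 1 ≤ i → i ≤ length xs → nth xs i ∈ xs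
nth-∈ (x ∷ xs) {suc zero}    _ _         = here refl
nth-∈ (x ∷ xs) {suc (suc i)} _ (s≤s i≤) = there (nth-∈ xs z<s i≤)

nth-++ˡ : ∀ xs ys {i} → i ≤ length xs → nth (xs ++ ys) i ≡ nth xs i
nth-++ˡ []       []       {zero} _ = refl
nth-++ˡ []       (y ∷ ys) {zero} _ = refl
nth-++ˡ (x ∷ xs) ys {zero}        _ = refl
nth-++ˡ (x ∷ xs) ys {suc zero}    _ = refl
nth-++ˡ (x ∷ xs) ys {suc (suc i)} (s≤s i≤) = nth-++ˡ xs ys i≤

nth-++-∷ : ∀ xs {v} ys → nth (xs ++ v ∷ ys) (suc (length xs)) ≡ v
nth-++-∷ []       ys = refl
nth-++-∷ (x ∷ xs) ys = nth-++-∷ xs ys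

nth-map : ∀ (g : ℕ → ℕ) xs {i} → 1 ≤ i → i ≤ length xs → nth (map g xs) i ≡ g (nth xs i)
nth-map g (x ∷ xs) {suc zero}    _ _         = refl
nth-map g (x ∷ xs) {suc (suc i)} _ (s≤s i≤) = nth-map g xs z<s i≤

map-nth-range : ∀ xs → map (nth xs) (range 1 (length xs)) ≡ xs
map-nth-range []       = refl
map-nth-range (x ∷ xs) = cong (x ∷_) (trans (shifted 0 (length xs)) (map-nth-range xs))
  where
  shifted : ∀ a m → map (nth (x ∷ xs)) (range (2 + a) m) ≡ map (nth xs) (range (suc a) m)
  shifted a zero    = refl
  shifted a (suc m) = cong (nth xs (suc a) ∷_) (shifted (suc a) m)

nth-injective : ∀ xs {i j} → Unique xs → 1 ≤ i → i ≤ length xs → 1 ≤ j → j ≤ length xs → nth xs i ≡ nth xs j → i ≡ j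
nth-injective (x ∷ xs) {suc zero}    {suc zero}    _           _ _         _ _         _  = refl
nth-injective (x ∷ xs) {suc zero}    {suc (suc j)} (x∉xs ∷ _) _ _         _ (s≤s j≤) eq =
  contradiction eq (All.lookup x∉xs (nth-∈ xs z<s j≤))
nth-injective (x ∷ xs) {suc (suc i)} {suc zero}    (x∉xs ∷ _) _ (s≤s i≤) _ _         eq =
  contradiction (sym eq) (All.lookup x∉xs (nth-∈ xs z<s i≤))
nth-injective (x ∷ xs) {suc (suc i)} {suc (suc j)} (_ ∷ xs!)   _ (s≤s i≤) _ (s≤s j≤) eq =
  cong suc (nth-injective xs xs! z<s i≤ z<s j≤ eq)

length-setAt : ∀ p v w → length (setAt p v w) ≡ length w
length-setAt p             v []      = refl
length-setAt zero          v (x ∷ w) = refl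
length-setAt (suc zero)    v (x ∷ w) = refl
length-setAt (suc (suc p)) v (x ∷ w) = cong suc (length-setAt (suc p) v w)

nth-setAt-≡ : ∀ p v w → 1 ≤ p → p ≤ length w → nth (setAt p v w) p ≡ v
nth-setAt-≡ (suc zero)    v (x ∷ w) _ _         = refl
nth-setAt-≡ (suc (suc p)) v (x ∷ w) _ (s≤s p≤) = nth-setAt-≡ (suc p) v w z<s p≤

nth-setAt-≢ : ∀ p v w {i} → i ≢ p → nth (setAt p v w) i ≡ nth w i
nth-setAt-≢ p             v []      _   = refl
nth-setAt-≢ zero          v (x ∷ w) _   = refl
nth-setAt-≢ (suc zero)    v (x ∷ w) {zero}        _   = refl
nth-setAt-≢ (suc zero)    v (x ∷ w) {suc zero}    i≢p = contradiction refl i≢p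
nth-setAt-≢ (suc zero)    v (x ∷ w) {suc (suc i)} _   = refl
nth-setAt-≢ (suc (suc p)) v (x ∷ w) {zero}        _   = refl
nth-setAt-≢ (suc (suc p)) v (x ∷ w) {suc zero}    _   = refl
nth-setAt-≢ (suc (suc p)) v (x ∷ w) {suc (suc i)} i≢p = nth-setAt-≢ (suc p) v w (i≢p ∘ cong suc)

length-applyUpdates : ∀ us w → length (applyUpdates us w) ≡ length w
length-applyUpdates []             w = refl
length-applyUpdates ((p , v) ∷ us) w = trans (length-applyUpdates us (setAt p v w)) (length-setAt p v w)

nth-applyUpdates-∉ : ∀ ps vs w {i} → i ∉ ps → nth (applyUpdates (zip ps vs) w) i ≡ nth w i
nth-applyUpdates-∉ []       vs       w i∉ = refl
nth-applyUpdates-∉ (p ∷ ps) []       w i∉ = refl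
nth-applyUpdates-∉ (p ∷ ps) (v ∷ vs) w i∉ =
  trans (nth-applyUpdates-∉ ps vs (setAt p v w) (i∉ ∘ there)) (nth-setAt-≢ p v w (i∉ ∘ here))

map-nth-applyUpdates : ∀ ps vs w → Unique ps → All (λ p → 1 ≤ p × p ≤ length w) ps → length ps ≤ length vs →
                       map (nth (applyUpdates (zip ps vs) w)) ps ≡ take (length ps) vs
map-nth-applyUpdates []       vs       w _           _                      _         = refl
map-nth-applyUpdates (p ∷ ps) (v ∷ vs) w (p∉ps ∷ ps!) ((1≤p , p≤) ∷ ps-in) (s≤s ps≤) = cong₂ _∷_
  (trans (nth-applyUpdates-∉ ps vs (setAt p v w) λ p∈ps → All.lookup p∉ps p∈ps refl) (nth-setAt-≡ p v w 1≤p p≤))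
  (map-nth-applyUpdates ps vs (setAt p v w) ps!
     (All.map (λ (1≤q , q≤) → 1≤q , subst (_ ≤_) (sym (length-setAt p v w)) q≤) ps-in) ps≤)

take-length-∷ʳ : ∀ (f : ℕ → ℕ) K m v → take (length (K ++ [ m ])) (v ∷ map f (K ++ [ m ])) ≡ v ∷ map f K
take-length-∷ʳ f []       m v = refl
take-length-∷ʳ f (k ∷ K) m v = cong (v ∷_) (take-length-∷ʳ f K m (f k))

-- Steps 2 and 3 of φ: v goes to the first position of ks, and the letter of σ at each position of ks moves to the next one.
shiftAlong : List ℕ → List ℕ → ℕ → List ℕ → List ℕ
shiftAlong σ ks v w = applyUpdates ((nth ks 1 , v) ∷ shiftUpdates σ ks) w

module ShiftAlong (σ w : List ℕ) {L : ℕ} (len-w : length w ≡ suc L) {K : List ℕ}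
                  (K↑ : AllPairs _<_ K) (K⊆ : All (_∈ range 1 L) K) (v : ℕ) where

  path : List ℕ
  path = K ++ [ suc L ]

  private
    updates-zip : ∀ K → (nth (K ++ [ suc L ]) 1 , v) ∷ shiftUpdates σ (K ++ [ suc L ]) ≡ zip (K ++ [ suc L ]) (v ∷ map (nth σ) (K ++ [ suc L ]))
    updates-zip []      = refl
    updates-zip (_ ∷ _) = refl

    K-bounds : All (λ k → 1 ≤ k × k < suc L) K
    K-bounds = All.map (λ k∈ → let (1≤k , k<) = ∈-range⁻ 1 L k∈ in 1≤k , k<) K⊆

  path↑ : AllPairs _<_ path
  path↑ = AllPairs.++⁺ K↑ ([] ∷ []) (All.map (λ (_ , k<) → k< ∷ []) K-bounds)

  path-bounds : All (λ p → 1 ≤ p × p ≤ length w) path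
  path-bounds = All.++⁺ (All.map (λ (1≤k , k<) → 1≤k , subst (_ ≤_) (sym len-w) (<⇒≤ k<)) K-bounds)
                        ((z<s , ≤-reflexive (sym len-w)) ∷ [])

  nth-shiftAlong-∉ : ∀ {i} → i ∉ path → nth (shiftAlong σ path v w) i ≡ nth w i
  nth-shiftAlong-∉ i∉ = trans (cong (λ us → nth (applyUpdates us w) _) (updates-zip K))
                              (nth-applyUpdates-∉ path (v ∷ map (nth σ) path) w i∉)

  map-nth-shiftAlong : map (nth (shiftAlong σ path v w)) path ≡ v ∷ map (nth σ) K
  map-nth-shiftAlong = begin
    map (nth (shiftAlong σ path v w)) path
      ≡⟨ cong (λ us → map (nth (applyUpdates us w)) path) (updates-zip K) ⟩
    map (nth (applyUpdates (zip path (v ∷ map (nth σ) path)) w)) path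
      ≡⟨ map-nth-applyUpdates path _ w (AllPairs.map <⇒≢ path↑) path-bounds
           (≤-trans (n≤1+n _) (≤-reflexive (cong suc (sym (length-map (nth σ) path))))) ⟩
    take (length path) (v ∷ map (nth σ) path)
      ≡⟨ take-length-∷ʳ (nth σ) K (suc L) v ⟩
    v ∷ map (nth σ) K ∎
    where open ≡-Reasoning

shift-nonExcedances : ∀ (f h : ℕ → ℕ) K m v → AllPairs _<_ (K ++ [ m ]) → All (λ k → f k ≤ k) K → All (v ≤_) (K ++ [ m ]) →
                      map h (K ++ [ m ]) ≡ v ∷ map f K → All (λ q → h q ≤ q) (K ++ [ m ])
shift-nonExcedances f h []      m v _              _             (v≤m ∷ _)  eq =
  subst (_≤ m) (sym (proj₁ (∷-injective eq))) v≤m ∷ []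
shift-nonExcedances f h (k ∷ K) m v (k<rest ∷ K↑) (fk≤k ∷ f≤K) (v≤k ∷ _) eq =
  subst (_≤ k) (sym (proj₁ (∷-injective eq))) v≤k ∷
  shift-nonExcedances f h K m (f k) K↑ f≤K (All.map (λ k<q → ≤-trans fk≤k (<⇒≤ k<q)) k<rest) (proj₂ (∷-injective eq))

-- Sorting

head-minimal : ∀ {x y xs} → AllPairs _<_ (x ∷ xs) → y ∈ x ∷ xs → x ≤ y
head-minimal _           (here refl) = ≤-refl
head-minimal (x<xs ∷ _) (there y∈)  = <⇒≤ (All.lookup x<xs y∈)

count-≥-nth : ∀ xs {d} → AllPairs _<_ xs → 1 ≤ d → d ≤ length xs → count (nth xs d ≤?_) xs ≡ suc (length xs) ∸ d
count-≥-nth (x ∷ xs) {suc zero} x∷xs↑ _ _ =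
  count-all (x ≤?_) (≤-refl ∷ All.map <⇒≤ (AllPairs.head x∷xs↑))
count-≥-nth (x ∷ xs) {suc (suc d)} (x<xs ∷ xs↑) _ (s≤s d≤) =
  trans (cong length (filter-reject (nth xs (suc d) ≤?_) (<⇒≱ (All.lookup x<xs (nth-∈ xs z<s d≤)))))
        (count-≥-nth xs xs↑ z<s d≤)

insert-↭ : ∀ x ys → insert x ys ↭ x ∷ ys
insert-↭ x []       = ↭-refl
insert-↭ x (y ∷ ys) with x ≤ᵇ y
... | true  = ↭-refl
... | false = ↭-trans (↭-prep y (insert-↭ x ys)) (↭-swap y x ↭-refl)

isort-↭ : ∀ xs → isort xs ↭ xs
isort-↭ []       = ↭-refl
isort-↭ (x ∷ xs) = ↭-trans (insert-↭ x (isort xs)) (↭-prep x (isort-↭ xs))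

insert-increasing : ∀ x ys → All (x ≢_) ys → AllPairs _<_ ys → AllPairs _<_ (insert x ys)
insert-increasing x []       _             _            = [] ∷ []
insert-increasing x (y ∷ ys) (x≢y ∷ x∉ys) (y<ys ∷ ys↑) with x ≤ᵇ y | ≤ᵇ-reflects-≤ x y
... | true  | ofʸ x≤y = let x<y = ≤∧≢⇒< x≤y x≢y in (x<y ∷ All.map (<-trans x<y) y<ys) ∷ y<ys ∷ ys↑
... | false | ofⁿ x≰y = All-resp-↭ (↭-sym (insert-↭ x ys)) (≰⇒> x≰y ∷ y<ys) ∷ insert-increasing x ys x∉ys ys↑

isort-increasing : ∀ xs → Unique xs → AllPairs _<_ (isort xs)
isort-increasing []       []           = []
isort-increasing (x ∷ xs) (x∉xs ∷ xs!) =
  insert-increasing x (isort xs) (All-resp-↭ (↭-sym (isort-↭ xs)) x∉xs) (isort-increasing xs xs!)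

-- Inversions

+-exchange : ∀ a b c → a + (b + c) ≡ b + (a + c)
+-exchange = solve-∀

inv-∷ : ∀ x xs → inv (x ∷ xs) ≡ count (_<? x) xs + inv xs
inv-∷ x xs = cong (λ ys → length ys + inv xs) (filterᵇ-does (_<? x) xs)

cross : List ℕ → List ℕ → ℕ
cross U V = sum (map (λ v → count (v <?_) U) V)

cross-[]ˡ : ∀ V → cross [] V ≡ 0
cross-[]ˡ []      = refl
cross-[]ˡ (_ ∷ V) = cross-[]ˡ V

cross-∷ˡ : ∀ u U V → cross (u ∷ U) V ≡ count (_<? u) V + cross U V
cross-∷ˡ u U []      = refl
cross-∷ˡ u U (v ∷ V) with does (v <? u)
... | true  = cong suc (trans (cong (count (v <?_) U +_) (cross-∷ˡ u U V)) (+-exchange (count (v <?_) U) (count (_<? u) V) (cross U V)))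
... | false = trans (cong (count (v <?_) U +_) (cross-∷ˡ u U V)) (+-exchange (count (v <?_) U) (count (_<? u) V) (cross U V))

inv-++ : ∀ U V → inv (U ++ V) ≡ inv U + inv V + cross U V
inv-++ []      V = sym (trans (cong (inv V +_) (cross-[]ˡ V)) (+-identityʳ (inv V)))
inv-++ (u ∷ U) V = begin
  inv (u ∷ U ++ V)                                                   ≡⟨ inv-∷ u (U ++ V) ⟩
  count (_<? u) (U ++ V) + inv (U ++ V)                              ≡⟨ cong₂ _+_ (count-++ (_<? u) U V) (inv-++ U V) ⟩
  count (_<? u) U + count (_<? u) V + (inv U + inv V + cross U V)
    ≡⟨ rearrange (count (_<? u) U) (count (_<? u) V) (inv U) (inv V) (cross U V) ⟩
  count (_<? u) U + inv U + inv V + (count (_<? u) V + cross U V)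
    ≡⟨ cong₂ _+_ (cong (_+ inv V) (sym (inv-∷ u U))) (sym (cross-∷ˡ u U V)) ⟩
  inv (u ∷ U) + inv V + cross (u ∷ U) V                              ∎
  where open ≡-Reasoning
        rearrange : ∀ a b c d e → a + b + (c + d + e) ≡ a + c + d + (b + e)
        rearrange = solve-∀

inv-insert : ∀ U x V → inv (U ++ x ∷ V) ≡ inv (U ++ V) + count (x <?_) U + count (_<? x) V
inv-insert U x V = begin
  inv (U ++ x ∷ V)                                                        ≡⟨ inv-++ U (x ∷ V) ⟩
  inv U + inv (x ∷ V) + (count (x <?_) U + cross U V)
    ≡⟨ cong (λ n → inv U + n + (count (x <?_) U + cross U V)) (inv-∷ x V) ⟩
  inv U + (count (_<? x) V + inv V) + (count (x <?_) U + cross U V)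
    ≡⟨ rearrange (inv U) (count (_<? x) V) (inv V) (count (x <?_) U) (cross U V) ⟩
  inv U + inv V + cross U V + count (x <?_) U + count (_<? x) V
    ≡⟨ cong (λ n → n + count (x <?_) U + count (_<? x) V) (sym (inv-++ U V)) ⟩
  inv (U ++ V) + count (x <?_) U + count (_<? x) V                        ∎
  where open ≡-Reasoning
        rearrange : ∀ a b c d e → a + (b + c) + (d + e) ≡ a + c + e + d + b
        rearrange = solve-∀

inv-∷ʳ-max : ∀ U m → All (_< m) U → inv (U ++ [ m ]) ≡ inv U
inv-∷ʳ-max U m U<m = begin
  inv (U ++ [ m ])                       ≡⟨ inv-insert U m [] ⟩
  inv (U ++ []) + count (m <?_) U + 0
    ≡⟨ cong₂ (λ xs n → inv xs + n + 0) (++-identityʳ U) (count-none (m <?_) (All.map <⇒≯ U<m)) ⟩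
  inv U + 0 + 0                          ≡⟨ cong (_+ 0) (+-identityʳ (inv U)) ⟩
  inv U + 0                              ≡⟨ +-identityʳ (inv U) ⟩
  inv U                                  ∎
  where open ≡-Reasoning

inv-map-monotone : ∀ (g : ℕ → ℕ) U → (∀ {x y} → x ∈ U → y ∈ U → x < y → g x < g y) → inv (map g U) ≡ inv U
inv-map-monotone g []      _    = refl
inv-map-monotone g (u ∷ U) mono = begin
  inv (g u ∷ map g U)                       ≡⟨ inv-∷ (g u) (map g U) ⟩
  count (_<? g u) (map g U) + inv (map g U)
    ≡⟨ cong₂ _+_ (trans (count-map (_<? g u) g U) (count-cong-local _ _ reflects))
                 (inv-map-monotone g U (λ x∈ y∈ → mono (there x∈) (there y∈))) ⟩
  count (_<? u) U + inv U                   ≡⟨ inv-∷ u U ⟨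
  inv (u ∷ U)                               ∎
  where open ≡-Reasoning
        reflects : ∀ {y} → y ∈ U → g y < g u ⇔ y < u
        reflects {y} y∈ = mk⇔ from (mono (there y∈) (here refl))
          where from : g y < g u → y < u
                from gy<gu with <-cmp y u
                ... | tri< y<u _ _ = y<u
                ... | tri≈ _ refl _ = contradiction gy<gu (<-irrefl refl)
                ... | tri> _ _ u<y = contradiction (mono (here refl) (there y∈) u<y) (<⇒≯ gy<gu)

sum-map-suc : ∀ (h : ℕ → ℕ) xs → sum (map (suc ∘ h) xs) ≡ sum (map h xs) + length xs
sum-map-suc h []       = refl
sum-map-suc h (x ∷ xs) = trans (cong (λ n → suc (h x + n)) (sum-map-suc h xs)) (rearrange (h x) _ _)
  where rearrange : ∀ a b c → suc (a + (b + c)) ≡ a + b + suc c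
        rearrange = solve-∀

-- Step 1 of φ: each letter of J moves to the next letter of J ++ [ m ]

nextIn-≡ : ∀ a b rs → nextIn (a ∷ b ∷ rs) a ≡ b
nextIn-≡ a b rs with a ≡ᵇ a | ≡⇒≡ᵇ a a refl
... | true | _ = refl

nextIn-≢ : ∀ {v a} xs → v ≢ a → nextIn (a ∷ xs) v ≡ nextIn xs v
nextIn-≢ []       _   = refl
nextIn-≢ {v} {a} (b ∷ rs) v≢a with v ≡ᵇ a | ≡ᵇ⇒≡ v a
... | true  | v≡a = contradiction (v≡a _) v≢a
... | false | _   = refl

nextIn-∉ : ∀ J m {v} → v ∉ J → nextIn (J ++ [ m ]) v ≡ v
nextIn-∉ []      m v∉ = refl
nextIn-∉ (a ∷ J) m v∉ = trans (nextIn-≢ (J ++ [ m ]) (v∉ ∘ here)) (nextIn-∉ J m (v∉ ∘ there))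

module _ (m : ℕ) where

  private
    nextIn-first : ∀ a J → AllPairs _<_ (a ∷ J ++ [ m ]) →
                   a < nextIn (a ∷ J ++ [ m ]) a × (∀ {y} → y ∈ J ++ [ m ] → nextIn (a ∷ J ++ [ m ]) a ≤ y)
    nextIn-first a []      ((a<m ∷ []) ∷ _) rewrite nextIn-≡ a m [] = a<m , λ { (here refl) → ≤-refl }
    nextIn-first a (b ∷ J) ((a<b ∷ _) ∷ b∷J↑) rewrite nextIn-≡ a b (J ++ [ m ]) = a<b , head-minimal b∷J↑

  nextIn-increasing : ∀ J {x} → AllPairs _<_ (J ++ [ m ]) → x ∈ J → x < nextIn (J ++ [ m ]) x
  nextIn-increasing (a ∷ J) a∷J↑     (here refl) = proj₁ (nextIn-first a J a∷J↑)
  nextIn-increasing (a ∷ J) (a< ∷ J↑) (there x∈) =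
    subst (_ <_) (sym (nextIn-≢ (J ++ [ m ]) (<⇒≢ (All.lookup a< (∈-++⁺ˡ x∈)) ∘ sym))) (nextIn-increasing J J↑ x∈)

  nextIn-monotone : ∀ J {x y} → AllPairs _<_ (J ++ [ m ]) → x ∈ J → y ∈ J → x < y → nextIn (J ++ [ m ]) x < nextIn (J ++ [ m ]) y
  nextIn-monotone (a ∷ J) (a< ∷ J↑) (here refl) (there y∈) a<y =
    ≤-<-trans (proj₂ (nextIn-first a J (a< ∷ J↑)) (∈-++⁺ˡ y∈))
              (subst (_ <_) (sym (nextIn-≢ (J ++ [ m ]) (<⇒≢ a<y ∘ sym))) (nextIn-increasing J J↑ y∈))
  nextIn-monotone (a ∷ J) _         (here refl) (here refl) a<a = contradiction a<a (<-irrefl refl)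
  nextIn-monotone (a ∷ J) (a< ∷ J↑) (there x∈) (here refl) x<a = contradiction (All.lookup a< (∈-++⁺ˡ x∈)) (<⇒≯ x<a)
  nextIn-monotone (a ∷ J) (a< ∷ J↑) (there x∈) (there y∈) x<y =
    subst₂ _<_ (sym (nextIn-≢ (J ++ [ m ]) (<⇒≢ (All.lookup a< (∈-++⁺ˡ x∈)) ∘ sym)))
               (sym (nextIn-≢ (J ++ [ m ]) (<⇒≢ (All.lookup a< (∈-++⁺ˡ y∈)) ∘ sym)))
               (nextIn-monotone J J↑ x∈ y∈ x<y)

  map-nextIn : ∀ J → AllPairs _<_ (J ++ [ m ]) → map (nextIn (J ++ [ m ])) J ≡ tl (J ++ [ m ])
  map-nextIn []          _             = refl
  map-nextIn (a ∷ [])    _             = cong [_] (nextIn-≡ a m [])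
  map-nextIn (a ∷ b ∷ J) (a< ∷ b∷J↑) = cong₂ _∷_ (nextIn-≡ a b (J ++ [ m ])) (begin
    map (nextIn (a ∷ b ∷ J ++ [ m ])) (b ∷ J)
      ≡⟨ map-cong-local (All.map (λ a<x → nextIn-≢ (b ∷ J ++ [ m ]) (<⇒≢ a<x ∘ sym)) (All.++⁻ˡ (b ∷ J) a<)) ⟩
    map (nextIn (b ∷ J ++ [ m ])) (b ∷ J)     ≡⟨ map-nextIn (b ∷ J) b∷J↑ ⟩
    J ++ [ m ]                                ∎)
    where open ≡-Reasoning

  -- J is mapped onto the tail of J ++ [ m ], which trades its least letter (at most v) for m (above v).
  count-map-nextIn : ∀ J {y v} → AllPairs _<_ (J ++ [ m ]) → y ∈ J → y ≤ v → v < m →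
                     count (v <?_) (map (nextIn (J ++ [ m ])) J) ≡ suc (count (v <?_) J)
  count-map-nextIn (j ∷ J) {y} {v} j∷J↑ y∈ y≤v v<m = begin
    count (v <?_) (map (nextIn (j ∷ J ++ [ m ])) (j ∷ J)) ≡⟨ cong (count (v <?_)) (map-nextIn (j ∷ J) j∷J↑) ⟩
    count (v <?_) (J ++ [ m ])                            ≡⟨ count-++ (v <?_) J [ m ] ⟩
    count (v <?_) J + count (v <?_) [ m ]                 ≡⟨ cong (count (v <?_) J +_) (count-all (v <?_) (v<m ∷ [])) ⟩
    count (v <?_) J + 1                                   ≡⟨ +-comm (count (v <?_) J) 1 ⟩
    suc (count (v <?_) J)                                 ≡⟨ cong (suc ∘ length) (filter-reject (v <?_) v≮j) ⟨
    suc (count (v <?_) (j ∷ J))                           ∎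
    where open ≡-Reasoning
          v≮j : ¬ v < j
          v≮j = ≤⇒≯ (≤-trans (head-minimal j∷J↑ (∈-++⁺ˡ y∈)) y≤v)

-- Excedances

Exc-extension : ∀ L w {P : Pred ℕ 0ℓ} (P? : Decidable P) → length w ≡ suc L →
                (∀ {i} → i ∈ range 1 L → i < nth w i ⇔ P i) → nth w (suc L) ≤ suc L →
                Exc w ≡ filter P? (range 1 L) × NonExc w ≡ filter (∁? P?) (range 1 L) ++ [ suc L ]
Exc-extension L w {P} P? len-w exc⇔P w[L+1]≤ = Exc-w , NonExc-w
  where
  open ≡-Reasoning
  exc? : Decidable (λ i → i < nth w i)
  exc? i = i <? nth w i

  positions-w : positions (length w) ≡ range 1 L ++ [ suc L ]
  positions-w = trans (cong positions len-w) (trans (positions≡range (suc L)) (range-∷ʳ 1 L))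

  Exc-w : Exc w ≡ filter P? (range 1 L)
  Exc-w = begin
    filterᵇ (isExc w) (positions (length w))                 ≡⟨ filterᵇ-does exc? (positions (length w)) ⟩
    filter exc? (positions (length w))                       ≡⟨ cong (filter exc?) positions-w ⟩
    filter exc? (range 1 L ++ [ suc L ])                     ≡⟨ filter-++ exc? (range 1 L) [ suc L ] ⟩
    filter exc? (range 1 L) ++ filter exc? [ suc L ]
      ≡⟨ cong₂ _++_ (filter-cong-local exc? P? exc⇔P) (filter-reject exc? (≤⇒≯ w[L+1]≤)) ⟩
    filter P? (range 1 L) ++ []                              ≡⟨ ++-identityʳ (filter P? (range 1 L)) ⟩
    filter P? (range 1 L)                                    ∎

  NonExc-w : NonExc w ≡ filter (∁? P?) (range 1 L) ++ [ suc L ]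
  NonExc-w = begin
    filterᵇ (λ i → not (isExc w i)) (positions (length w))  ≡⟨ filterᵇ-does (∁? exc?) (positions (length w)) ⟩
    filter (∁? exc?) (positions (length w))                  ≡⟨ cong (filter (∁? exc?)) positions-w ⟩
    filter (∁? exc?) (range 1 L ++ [ suc L ])                ≡⟨ filter-++ (∁? exc?) (range 1 L) [ suc L ] ⟩
    filter (∁? exc?) (range 1 L) ++ filter (∁? exc?) [ suc L ]
      ≡⟨ cong₂ _++_ (filter-cong-local (∁? exc?) (∁? P?) (¬-cong-⇔ ∘ exc⇔P))
                    (filter-accept (∁? exc?) (≤⇒≯ w[L+1]≤)) ⟩
    filter (∁? P?) (range 1 L) ++ [ suc L ]                  ∎

den-via-Exc : ∀ w {X Y} → Exc w ≡ X → NonExc w ≡ Y → den w ≡ sum X + inv (map (nth w) X) + inv (map (nth w) Y)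
den-via-Exc w refl refl = refl

∈-++-∷⇔ : ∀ (X : List ℕ) {k} Y {i} → i ∈ X ++ k ∷ Y ⇔ (i ∈ X ++ Y ⊎ i ≡ k)
∈-++-∷⇔ X {k} Y = mk⇔ to from
  where
  to : ∀ {i} → i ∈ X ++ k ∷ Y → i ∈ X ++ Y ⊎ i ≡ k
  to i∈ with ∈-resp-↭ (shift k X Y) i∈
  ... | here i≡k   = inj₂ i≡k
  ... | there i∈′ = inj₁ i∈′
  from : ∀ {i} → i ∈ X ++ Y ⊎ i ≡ k → i ∈ X ++ k ∷ Y
  from (inj₁ i∈)  = ∈-resp-↭ (↭-sym (shift k X Y)) (there i∈)
  from (inj₂ i≡k) = ∈-resp-↭ (↭-sym (shift k X Y)) (here i≡k)

-- The letter e_d and the chain e_{j_1} < ⋯ < e_{j_x} of φ, restated outside the where-block of phiDen.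
pivot : List ℕ → ℕ → ℕ
pivot σ c = nth (isort (EXCL σ)) ((exc σ + 1) ∸ c)

chain : List ℕ → ℕ → List ℕ
chain σ e = isort (map (nth σ) (filterᵇ (λ p → (p <ᵇ e) ∧ (e ≤ᵇ nth σ p)) (Exc σ)))

phiDen-≤exc : ∀ L σ c → suc c ≤ exc σ →
              phiDen (suc L) σ (suc c) ≡
              shiftAlong σ (dropWhileᵇ (λ k → k <ᵇ pivot σ (suc c)) (NonExc σ ++ [ suc L ])) (pivot σ (suc c))
                         (map (nextIn (chain σ (pivot σ (suc c)) ++ [ suc L ])) σ ++ [ suc L ])
phiDen-≤exc L σ c c<s with suc c ≤ᵇ exc σ | ≤ᵇ-reflects-≤ (suc c) (exc σ)
... | true  | _        = refl
... | false | ofⁿ c≮s = contradiction c<s c≮s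

phiDen->exc : ∀ L σ c → exc σ < suc c →
              phiDen (suc L) σ (suc c) ≡
              shiftAlong σ (dropN ((suc c ∸ exc σ) ∸ 1) (NonExc σ ++ [ suc L ])) (suc L) (σ ++ [ suc L ])
phiDen->exc L σ c s<c with suc c ≤ᵇ exc σ | ≤ᵇ-reflects-≤ (suc c) (exc σ)
... | true  | ofʸ c≤s = contradiction c≤s (<⇒≱ s<c)
... | false | _       = refl

module Permutation {L : ℕ} {σ : List ℕ} (σ↭ : σ ↭ range 1 L) where

  σ[_] : ℕ → ℕ
  σ[ i ] = nth σ i

  R : List ℕ
  R = range 1 L

  length-σ : length σ ≡ L
  length-σ = trans (↭-length σ↭) (length-range 1 L)

  ∈R⁻ : ∀ {i} → i ∈ R → 1 ≤ i × i ≤ L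
  ∈R⁻ i∈ = let (1≤i , i<1+L) = ∈-range⁻ 1 L i∈ in 1≤i , s≤s⁻¹ i<1+L

  ∈R⇒index : ∀ {i} → i ∈ R → 1 ≤ i × i ≤ length σ
  ∈R⇒index {i} i∈ = let (1≤i , i≤L) = ∈R⁻ i∈ in 1≤i , subst (i ≤_) (sym length-σ) i≤L

  σ[]∈R : ∀ {i} → i ∈ R → σ[ i ] ∈ R
  σ[]∈R i∈ = let (1≤i , i≤) = ∈R⇒index i∈ in ∈-resp-↭ σ↭ (nth-∈ σ 1≤i i≤)

  σ[]<L+1 : ∀ {i} → i ∈ R → σ[ i ] < suc L
  σ[]<L+1 i∈ = s≤s (proj₂ (∈R⁻ (σ[]∈R i∈)))

  σ-unique : Unique σ
  σ-unique = Unique-resp-↭ (↭⇒↭ₛ (↭-sym σ↭)) (AllPairs.map <⇒≢ (range-increasing 1 L))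

  σ[]-injective : ∀ {i j} → i ∈ R → j ∈ R → σ[ i ] ≡ σ[ j ] → i ≡ j
  σ[]-injective i∈ j∈ = let (1≤i , i≤) = ∈R⇒index i∈ ; (1≤j , j≤) = ∈R⇒index j∈ in
    nth-injective σ σ-unique 1≤i i≤ 1≤j j≤

  map-σ[]-unique : ∀ {xs} → AllPairs _<_ xs → All (_∈ R) xs → Unique (map σ[_] xs)
  map-σ[]-unique []            []          = []
  map-σ[]-unique (x<xs ∷ xs↑) (x∈ ∷ xs∈) =
    All.map⁺ (All.zipWith (λ (x<y , y∈) → <⇒≢ x<y ∘ σ[]-injective x∈ y∈) (x<xs , xs∈)) ∷ map-σ[]-unique xs↑ xs∈

  count-σ[] : {P : Pred ℕ 0ℓ} (P? : Decidable P) → count (P? ∘ σ[_]) R ≡ count P? R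
  count-σ[] P? = begin
    count (P? ∘ σ[_]) R    ≡⟨ count-map P? σ[_] R ⟨
    count P? (map σ[_] R)  ≡⟨ cong (λ m → count P? (map σ[_] (range 1 m))) length-σ ⟨
    count P? (map σ[_] (range 1 (length σ))) ≡⟨ cong (count P?) (map-nth-range σ) ⟩
    count P? σ             ≡⟨ count-↭ P? σ↭ ⟩
    count P? R             ∎
    where open ≡-Reasoning

  exc? : Decidable (λ i → i < σ[ i ])
  exc? i = i <? σ[ i ]

  E NE : List ℕ
  E  = filter exc? R
  NE = filter (∁? exc?) R

  E↑ : AllPairs _<_ E
  E↑ = AllPairs.filter⁺ exc? (range-increasing 1 L)

  NE↑ : AllPairs _<_ NE
  NE↑ = AllPairs.filter⁺ (∁? exc?) (range-increasing 1 L)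

  ∈E⁻ : ∀ {i} → i ∈ E → i ∈ R × i < σ[ i ]
  ∈E⁻ = ∈-filter⁻ exc?

  ∈NE⁻ : ∀ {i} → i ∈ NE → i ∈ R × σ[ i ] ≤ i
  ∈NE⁻ i∈ = let (i∈R , ¬exc) = ∈-filter⁻ (∁? exc?) i∈ in i∈R , ≮⇒≥ ¬exc

  private
    positions-σ : positions (length σ) ≡ R
    positions-σ = trans (cong positions length-σ) (positions≡range L)

  Exc-σ : Exc σ ≡ E
  Exc-σ = trans (filterᵇ-does exc? (positions (length σ))) (cong (filter exc?) positions-σ)

  NonExc-σ : NonExc σ ≡ NE
  NonExc-σ = trans (filterᵇ-does (∁? exc?) (positions (length σ))) (cong (filter (∁? exc?)) positions-σ)

  den-σ : den σ ≡ sum E + inv (map σ[_] E) + inv (map σ[_] NE)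
  den-σ = den-via-Exc σ Exc-σ NonExc-σ

  module Threshold (t : ℕ) (1≤t : 1 ≤ t) (t≤L+1 : t ≤ suc L) where

    Lo Hi : List ℕ
    Lo = range 1 (t ∸ 1)
    Hi = range t (suc L ∸ t)

    R-split : R ≡ Lo ++ Hi
    R-split = range-split L t 1≤t t≤L+1

    Lo-< : ∀ {i} → i ∈ Lo → i < t
    Lo-< {i} i∈ = subst (i <_) (m+[n∸m]≡n 1≤t) (proj₂ (∈-range⁻ 1 (t ∸ 1) i∈))

    Hi-≥ : ∀ {i} → i ∈ Hi → t ≤ i
    Hi-≥ i∈ = proj₁ (∈-range⁻ t (suc L ∸ t) i∈)

    Lo⊆R : ∀ {i} → i ∈ Lo → i ∈ R
    Lo⊆R i∈ = subst (_ ∈_) (sym R-split) (∈-++⁺ˡ i∈)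

    Hi⊆R : ∀ {i} → i ∈ Hi → i ∈ R
    Hi⊆R i∈ = subst (_ ∈_) (sym R-split) (∈-++⁺ʳ Lo i∈)

    X Y A B : List ℕ
    X = filter exc? Lo
    Y = filter exc? Hi
    A = filter (∁? exc?) Lo
    B = filter (∁? exc?) Hi

    E-split : E ≡ X ++ Y
    E-split = trans (cong (filter exc?) R-split) (filter-++ exc? Lo Hi)

    NE-split : NE ≡ A ++ B
    NE-split = trans (cong (filter (∁? exc?)) R-split) (filter-++ (∁? exc?) Lo Hi)

    X⊆E : ∀ {i} → i ∈ X → i ∈ E
    X⊆E i∈ = subst (_ ∈_) (sym E-split) (∈-++⁺ˡ i∈)

    Y⊆E : ∀ {i} → i ∈ Y → i ∈ E
    Y⊆E i∈ = subst (_ ∈_) (sym E-split) (∈-++⁺ʳ X i∈)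

    length-X+A : length X + length A ≡ t ∸ 1
    length-X+A = trans (count-complement exc? Lo) (length-range 1 (t ∸ 1))

    -- σ maps R onto R, so positions and letters below t are equally many.
    crossings-balance : count (λ i → σ[ i ] <? t) Hi ≡ count (λ i → t ≤? σ[ i ]) Lo
    crossings-balance = +-cancelˡ-≡ (count below? Lo) _ _ (trans below-R (sym below-Lo))
      where
      open ≡-Reasoning
      below? : Decidable (λ i → σ[ i ] < t)
      below? i = σ[ i ] <? t

      below-R : count below? Lo + count below? Hi ≡ length Lo
      below-R = begin
        count below? Lo + count below? Hi          ≡⟨ count-++ below? Lo Hi ⟨
        count below? (Lo ++ Hi)                    ≡⟨ cong (count below?) R-split ⟨
        count below? R                             ≡⟨ count-σ[] (_<? t) ⟩
        count (_<? t) R                            ≡⟨ cong (count (_<? t)) R-split ⟩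
        count (_<? t) (Lo ++ Hi)                   ≡⟨ count-++ (_<? t) Lo Hi ⟩
        count (_<? t) Lo + count (_<? t) Hi
          ≡⟨ cong₂ _+_ (count-all (_<? t) (All.tabulate Lo-<)) (count-none (_<? t) (All.tabulate (≤⇒≯ ∘ Hi-≥))) ⟩
        length Lo + 0                              ≡⟨ +-identityʳ (length Lo) ⟩
        length Lo                                  ∎

      below-Lo : count below? Lo + count (λ i → t ≤? σ[ i ]) Lo ≡ length Lo
      below-Lo = trans (cong (count below? Lo +_)
                             (count-cong-local {xs = Lo} (λ i → t ≤? σ[ i ]) (∁? below?) (λ _ → mk⇔ ≤⇒≯ ≮⇒≥)))
                       (count-complement below? Lo)

  appended : List ℕ
  appended = σ ++ [ suc L ]

  length-appended : length appended ≡ suc L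
  length-appended = trans (length-++ σ) (trans (+-comm (length σ) 1) (cong suc length-σ))

  nth-appended : ∀ {i} → i ∈ R → nth appended i ≡ σ[ i ]
  nth-appended i∈ = nth-++ˡ σ [ suc L ] (proj₂ (∈R⇒index i∈))

  nth-appended-L+1 : nth appended (suc L) ≡ suc L
  nth-appended-L+1 = subst (λ m → nth appended (suc m) ≡ suc L) length-σ (nth-++-∷ σ [])

  excedance-appended : ∀ {i} → i ∈ R → i < nth appended i ⇔ i < σ[ i ]
  excedance-appended {i} i∈ = mk⇔ (subst (i <_) (nth-appended i∈)) (subst (i <_) (sym (nth-appended i∈)))

  Exc-appended : Exc appended ≡ E
  Exc-appended = proj₁ (Exc-extension L appended exc? length-appended excedance-appended (≤-reflexive nth-appended-L+1))

  NonExc-appended : NonExc appended ≡ NE ++ [ suc L ]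
  NonExc-appended = proj₂ (Exc-extension L appended exc? length-appended excedance-appended (≤-reflexive nth-appended-L+1))

  den-appended : den appended ≡ den σ
  den-appended = begin
    den appended
      ≡⟨ den-via-Exc appended Exc-appended NonExc-appended ⟩
    sum E + inv (map (nth appended) E) + inv (map (nth appended) (NE ++ [ suc L ]))
      ≡⟨ cong₂ (λ xs ys → sum E + inv xs + inv ys) (map-cong-local (All.tabulate (nth-appended ∘ proj₁ ∘ ∈E⁻)))
               (trans (map-++ (nth appended) NE [ suc L ])
                      (cong₂ _++_ (map-cong-local (All.tabulate (nth-appended ∘ proj₁ ∘ ∈NE⁻))) (cong [_] nth-appended-L+1))) ⟩
    sum E + inv (map σ[_] E) + inv (map σ[_] NE ++ [ suc L ])
      ≡⟨ cong (sum E + inv (map σ[_] E) +_)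
              (inv-∷ʳ-max (map σ[_] NE) (suc L) (All.map⁺ (All.tabulate (σ[]<L+1 ∘ proj₁ ∘ ∈NE⁻)))) ⟩
    sum E + inv (map σ[_] E) + inv (map σ[_] NE)                            ≡⟨ den-σ ⟨
    den σ                                                                     ∎
    where open ≡-Reasoning

module ExcedanceAdded {L : ℕ} {σ : List ℕ} (σ↭ : σ ↭ range 1 L) {c : ℕ} (s<c : exc σ < suc c) (c<L : suc c ≤ L) where

  open Permutation σ↭

  s d : ℕ
  s = exc σ
  d = suc c ∸ s

  s≡|E| : s ≡ length E
  s≡|E| = cong length Exc-σ

  1≤d : 1 ≤ d
  1≤d = m<n⇒0<n∸m s<c

  d≤|NE| : d ≤ length NE
  d≤|NE| = subst (d ≤_) L∸s≡|NE| (∸-monoˡ-≤ s c<L)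
    where L∸s≡|NE| : L ∸ s ≡ length NE
          L∸s≡|NE| = trans (cong₂ _∸_ (sym (trans (count-complement exc? R) (length-range 1 L))) s≡|E|)
                           (m+n∸m≡n (length E) (length NE))

  k : ℕ
  k = nth NE d

  k∈NE : k ∈ NE
  k∈NE = nth-∈ NE 1≤d d≤|NE|

  k∈R : k ∈ R
  k∈R = proj₁ (∈NE⁻ k∈NE)

  1≤k : 1 ≤ k
  1≤k = proj₁ (∈R⁻ k∈R)

  k≤L : k ≤ L
  k≤L = proj₂ (∈R⁻ k∈R)

  σ[k]≤k : σ[ k ] ≤ k
  σ[k]≤k = proj₂ (∈NE⁻ k∈NE)

  open Threshold k 1≤k (m≤n⇒m≤1+n k≤L)

  Hi′ B′ : List ℕ
  Hi′ = range (suc k) (L ∸ k)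
  B′  = filter (∁? exc?) Hi′

  Hi-∷ : Hi ≡ k ∷ Hi′
  Hi-∷ = cong (range k) (+-∸-assoc 1 k≤L)

  Y-Hi′ : Y ≡ filter exc? Hi′
  Y-Hi′ = trans (cong (filter exc?) Hi-∷) (filter-reject exc? (≤⇒≯ σ[k]≤k))

  B-∷ : B ≡ k ∷ B′
  B-∷ = trans (cong (filter (∁? exc?)) Hi-∷) (filter-accept (∁? exc?) (≤⇒≯ σ[k]≤k))

  NE-at-k : NE ≡ A ++ k ∷ B′
  NE-at-k = trans NE-split (cong (A ++_) B-∷)

  1+|A|≡d : suc (length A) ≡ d
  1+|A|≡d = nth-injective NE (AllPairs.map <⇒≢ NE↑) z<s 1+|A|≤ 1≤d d≤|NE|
              (trans (cong (λ xs → nth xs (suc (length A))) NE-at-k) (nth-++-∷ A B′))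
    where 1+|A|≤ : suc (length A) ≤ length NE
          1+|A|≤ = subst (suc (length A) ≤_) (sym (trans (cong length NE-at-k) (trans (length-++ A) (+-suc (length A) (length B′)))))
                         (m≤m+n (suc (length A)) (length B′))

  K↑ : AllPairs _<_ (k ∷ B′)
  K↑ = subst (AllPairs _<_) B-∷ (AllPairs.filter⁺ (∁? exc?) (range-increasing k (suc L ∸ k)))

  K⊆R : All (_∈ R) (k ∷ B′)
  K⊆R = subst (All (_∈ R)) B-∷ (All.tabulate (Hi⊆R ∘ proj₁ ∘ ∈-filter⁻ (∁? exc?)))

  B′-nonExc : All (λ q → σ[ q ] ≤ q) B′
  B′-nonExc = All.tail (subst (All (λ q → σ[ q ] ≤ q)) B-∷
                               (All.tabulate (≮⇒≥ ∘ proj₂ ∘ ∈-filter⁻ (∁? exc?) {xs = Hi})))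

  open ShiftAlong σ appended length-appended K↑ K⊆R (suc L)

  w : List ℕ
  w = shiftAlong σ path (suc L) appended

  phiDen≡w : phiDen (suc L) σ (suc c) ≡ w
  phiDen≡w = trans (phiDen->exc L σ c s<c) (cong (λ ks → shiftAlong σ ks (suc L) appended) suffix)
    where
    open ≡-Reasoning
    suffix : dropN (d ∸ 1) (NonExc σ ++ [ suc L ]) ≡ path
    suffix = begin
      dropN (d ∸ 1) (NonExc σ ++ [ suc L ])
        ≡⟨ cong₂ (λ i xs → dropN (i ∸ 1) (xs ++ [ suc L ])) (sym 1+|A|≡d) (trans NonExc-σ NE-at-k) ⟩
      dropN (length A) ((A ++ k ∷ B′) ++ [ suc L ])  ≡⟨ cong (dropN (length A)) (++-assoc A (k ∷ B′) [ suc L ]) ⟩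
      dropN (length A) (A ++ path)                   ≡⟨ dropN-++ A path ⟩
      path                                           ∎

  length-w : length w ≡ suc L
  length-w = trans (length-applyUpdates ((k , suc L) ∷ shiftUpdates σ path) appended) length-appended

  w[k] : nth w k ≡ suc L
  w[k] = proj₁ (∷-injective map-nth-shiftAlong)

  w-after-k : map (nth w) (B′ ++ [ suc L ]) ≡ map σ[_] (k ∷ B′)
  w-after-k = proj₂ (∷-injective map-nth-shiftAlong)

  w-after-k-≤ : All (λ q → nth w q ≤ q) (B′ ++ [ suc L ])
  w-after-k-≤ with path↑
  ... | k< ∷ rest↑ = shift-nonExcedances σ[_] (nth w) B′ (suc L) σ[ k ] rest↑ B′-nonExc
                       (All.map (λ k<q → ≤-trans σ[k]≤k (<⇒≤ k<q)) k<) w-after-k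

  w-off-path : ∀ {i} → i ∈ R → i ∉ path → nth w i ≡ σ[ i ]
  w-off-path i∈ i∉ = trans (nth-shiftAlong-∉ i∉) (nth-appended i∈)

  after-k-nonExc : ∀ {i} → i ∈ R → i ∈ B′ ++ [ suc L ] → σ[ i ] ≤ i × k < i
  after-k-nonExc i∈R i∈ with ∈-++⁻ B′ i∈ | path↑
  ... | inj₁ i∈B′        | k< ∷ _ = All.lookup B′-nonExc i∈B′ , All.lookup k< (∈-++⁺ˡ i∈B′)
  ... | inj₂ (here refl) | _      = contradiction (proj₂ (∈R⁻ i∈R)) (<⇒≱ ≤-refl)

  excedance-w : ∀ {i} → i ∈ R → i < nth w i ⇔ (i < σ[ i ] ⊎ i ≡ k)
  excedance-w {i} i∈R with i ∈? path
  ... | yes (here refl) = mk⇔ (λ _ → inj₂ refl) (λ _ → subst (k <_) (sym w[k]) (s≤s k≤L))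
  ... | yes (there i∈)  = let (σi≤i , k<i) = after-k-nonExc i∈R i∈ in
        mk⇔ (λ i<wi → contradiction (All.lookup w-after-k-≤ i∈) (<⇒≱ i<wi))
            (λ { (inj₁ i<σi) → contradiction σi≤i (<⇒≱ i<σi) ; (inj₂ refl) → contradiction refl (<⇒≢ k<i) })
  ... | no i∉ = mk⇔ (inj₁ ∘ subst (i <_) (w-off-path i∈R i∉))
                    (λ { (inj₁ i<σi) → subst (i <_) (sym (w-off-path i∈R i∉)) i<σi
                       ; (inj₂ refl)  → contradiction (here refl) i∉ })

  exc-or-k? : Decidable (λ i → i < σ[ i ] ⊎ i ≡ k)
  exc-or-k? i = exc? i ⊎-dec (i ≟ k)

  R-at-k : R ≡ Lo ++ k ∷ Hi′
  R-at-k = trans R-split (cong (Lo ++_) Hi-∷)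

  exc-or-k⇔exc : ∀ {i} → i ≢ k → (i < σ[ i ] ⊎ i ≡ k) ⇔ (i < σ[ i ])
  exc-or-k⇔exc i≢k = mk⇔ (λ { (inj₁ i<σi) → i<σi ; (inj₂ i≡k) → contradiction i≡k i≢k }) inj₁

  Lo-≢k : ∀ {i} → i ∈ Lo → i ≢ k
  Lo-≢k = <⇒≢ ∘ Lo-<

  Hi′-≢k : ∀ {i} → i ∈ Hi′ → i ≢ k
  Hi′-≢k i∈ = <⇒≢ (proj₁ (∈-range⁻ (suc k) (L ∸ k) i∈)) ∘ sym

  filter-exc-or-k : filter exc-or-k? R ≡ X ++ k ∷ Y
  filter-exc-or-k = begin
    filter exc-or-k? R                                          ≡⟨ cong (filter exc-or-k?) R-at-k ⟩
    filter exc-or-k? (Lo ++ k ∷ Hi′)                            ≡⟨ filter-++ exc-or-k? Lo (k ∷ Hi′) ⟩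
    filter exc-or-k? Lo ++ filter exc-or-k? (k ∷ Hi′)
      ≡⟨ cong (filter exc-or-k? Lo ++_) (filter-accept exc-or-k? (inj₂ refl)) ⟩
    filter exc-or-k? Lo ++ k ∷ filter exc-or-k? Hi′             ≡⟨ cong₂ (λ xs ys → xs ++ k ∷ ys)
                                                                     (filter-cong-local exc-or-k? exc? (exc-or-k⇔exc ∘ Lo-≢k))
                                                                     (trans (filter-cong-local exc-or-k? exc? (exc-or-k⇔exc ∘ Hi′-≢k)) (sym Y-Hi′)) ⟩
    X ++ k ∷ Y                                                  ∎
    where open ≡-Reasoning

  filter-neither : filter (∁? exc-or-k?) R ≡ A ++ B′
  filter-neither = begin
    filter (∁? exc-or-k?) R                                     ≡⟨ cong (filter (∁? exc-or-k?)) R-at-k ⟩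
    filter (∁? exc-or-k?) (Lo ++ k ∷ Hi′)                       ≡⟨ filter-++ (∁? exc-or-k?) Lo (k ∷ Hi′) ⟩
    filter (∁? exc-or-k?) Lo ++ filter (∁? exc-or-k?) (k ∷ Hi′)
      ≡⟨ cong (filter (∁? exc-or-k?) Lo ++_) (filter-reject (∁? exc-or-k?) (λ ¬P → ¬P (inj₂ refl))) ⟩
    filter (∁? exc-or-k?) Lo ++ filter (∁? exc-or-k?) Hi′       ≡⟨ cong₂ _++_ (filter-cong-local (∁? exc-or-k?) (∁? exc?) (¬-cong-⇔ ∘ exc-or-k⇔exc ∘ Lo-≢k))
                                                                              (filter-cong-local (∁? exc-or-k?) (∁? exc?) (¬-cong-⇔ ∘ exc-or-k⇔exc ∘ Hi′-≢k)) ⟩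
    A ++ B′                                                     ∎
    where open ≡-Reasoning

  w[L+1]≤ : nth w (suc L) ≤ suc L
  w[L+1]≤ = All.lookup w-after-k-≤ (∈-++⁺ʳ B′ (here refl))

  Exc-w : Exc w ≡ X ++ k ∷ Y
  Exc-w = trans (proj₁ (Exc-extension L w exc-or-k? length-w excedance-w w[L+1]≤)) filter-exc-or-k

  NonExc-w : NonExc w ≡ A ++ B′ ++ [ suc L ]
  NonExc-w = trans (proj₂ (Exc-extension L w exc-or-k? length-w excedance-w w[L+1]≤))
                   (trans (cong (_++ [ suc L ]) filter-neither) (++-assoc A B′ [ suc L ]))

  Exc-phiDen : ∀ i → i ∈ Exc (phiDen (suc L) σ (suc c)) ⇔ (i ∈ Exc σ ⊎ i ≡ nth (NonExc σ) d)
  Exc-phiDen i = subst₂ (λ U V → i ∈ U ⇔ (i ∈ V ⊎ i ≡ nth (NonExc σ) d))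
                        (sym (trans (cong Exc phiDen≡w) Exc-w)) (sym (trans Exc-σ E-split))
                        (subst (λ z → i ∈ X ++ k ∷ Y ⇔ (i ∈ X ++ Y ⊎ i ≡ z)) (cong (λ xs → nth xs d) (sym NonExc-σ))
                               (∈-++-∷⇔ X Y))

  E-off-path : ∀ {i} → i ∈ E → i ∉ path
  E-off-path i∈E (here refl) = contradiction (proj₂ (∈E⁻ i∈E)) (≤⇒≯ σ[k]≤k)
  E-off-path i∈E (there i∈)  =
    contradiction (proj₂ (∈E⁻ i∈E)) (≤⇒≯ (proj₁ (after-k-nonExc (proj₁ (∈E⁻ i∈E)) i∈)))

  w-on-E : ∀ {i} → i ∈ E → nth w i ≡ σ[ i ]
  w-on-E i∈E = w-off-path (proj₁ (∈E⁻ i∈E)) (E-off-path i∈E)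

  w-on-A : ∀ {i} → i ∈ A → nth w i ≡ σ[ i ]
  w-on-A i∈A = let (i∈Lo , _) = ∈-filter⁻ (∁? exc?) i∈A in
    w-off-path (Lo⊆R i∈Lo) (λ i∈path → contradiction (head-minimal path↑ i∈path) (<⇒≱ (Lo-< i∈Lo)))

  EXCL-w : map (nth w) (X ++ k ∷ Y) ≡ map σ[_] X ++ suc L ∷ map σ[_] Y
  EXCL-w = trans (map-++ (nth w) X (k ∷ Y))
                 (cong₂ _++_ (map-cong-local (All.tabulate (w-on-E ∘ X⊆E)))
                             (cong₂ _∷_ w[k] (map-cong-local (All.tabulate (w-on-E ∘ Y⊆E)))))

  inv-EXCL-w : inv (map (nth w) (X ++ k ∷ Y)) ≡ inv (map σ[_] E) + length Y
  inv-EXCL-w = begin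
    inv (map (nth w) (X ++ k ∷ Y))
      ≡⟨ cong inv EXCL-w ⟩
    inv (map σ[_] X ++ suc L ∷ map σ[_] Y)
      ≡⟨ inv-insert (map σ[_] X) (suc L) (map σ[_] Y) ⟩
    inv (map σ[_] X ++ map σ[_] Y) + count (suc L <?_) (map σ[_] X) + count (_<? suc L) (map σ[_] Y)
      ≡⟨ cong₂ (λ U n → inv U + n + count (_<? suc L) (map σ[_] Y))
               (trans (sym (map-++ σ[_] X Y)) (cong (map σ[_]) (sym E-split)))
               (count-none (suc L <?_) (All.map⁺ (All.tabulate (<⇒≯ ∘ σ[]<L+1 ∘ proj₁ ∘ ∈E⁻ ∘ X⊆E)))) ⟩
    inv (map σ[_] E) + 0 + count (_<? suc L) (map σ[_] Y)
      ≡⟨ cong₂ _+_ (+-identityʳ _)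
                   (trans (count-all (_<? suc L) (All.map⁺ (All.tabulate (σ[]<L+1 ∘ proj₁ ∘ ∈E⁻ ∘ Y⊆E)))) (length-map σ[_] Y)) ⟩
    inv (map σ[_] E) + length Y ∎
    where open ≡-Reasoning

  NEXCL-w : map (nth w) (A ++ B′ ++ [ suc L ]) ≡ map σ[_] NE
  NEXCL-w = begin
    map (nth w) (A ++ B′ ++ [ suc L ])               ≡⟨ map-++ (nth w) A (B′ ++ [ suc L ]) ⟩
    map (nth w) A ++ map (nth w) (B′ ++ [ suc L ])   ≡⟨ cong₂ _++_ (map-cong-local (All.tabulate w-on-A)) w-after-k ⟩
    map σ[_] A ++ map σ[_] (k ∷ B′)                  ≡⟨ map-++ σ[_] A (k ∷ B′) ⟨
    map σ[_] (A ++ k ∷ B′)                           ≡⟨ cong (map σ[_]) NE-at-k ⟨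
    map σ[_] NE                                      ∎
    where open ≡-Reasoning

  k+|Y|≡c : k + length Y ≡ suc c
  k+|Y|≡c = begin
    k + length Y
      ≡⟨ cong (_+ length Y) (trans (sym (m+[n∸m]≡n 1≤k)) (cong suc (sym length-X+A))) ⟩
    suc (length X + length A) + length Y        ≡⟨ rearrange (length X) (length A) (length Y) ⟩
    (length X + length Y) + suc (length A)
      ≡⟨ cong₂ _+_ (sym (trans s≡|E| (trans (cong length E-split) (length-++ X)))) 1+|A|≡d ⟩
    s + d                                       ≡⟨ m+[n∸m]≡n (<⇒≤ s<c) ⟩
    suc c                                       ∎
    where open ≡-Reasoning
          rearrange : ∀ a b c → suc (a + b) + c ≡ a + c + suc b
          rearrange = solve-∀

  den-phiDen : den (phiDen (suc L) σ (suc c)) ≡ den σ + suc c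
  den-phiDen = begin
    den (phiDen (suc L) σ (suc c))                                                          ≡⟨ cong den phiDen≡w ⟩
    den w                                                                                   ≡⟨ den-via-Exc w Exc-w NonExc-w ⟩
    sum (X ++ k ∷ Y) + inv (map (nth w) (X ++ k ∷ Y)) + inv (map (nth w) (A ++ B′ ++ [ suc L ]))
      ≡⟨ cong₂ _+_ (cong₂ _+_ (trans (sum-↭ (shift k X Y)) (cong (λ U → k + sum U) (sym E-split))) inv-EXCL-w)
                   (cong inv NEXCL-w) ⟩
    k + sum E + (inv (map σ[_] E) + length Y) + inv (map σ[_] NE)
      ≡⟨ rearrange k (sum E) _ (length Y) _ ⟩
    sum E + inv (map σ[_] E) + inv (map σ[_] NE) + (k + length Y)
      ≡⟨ cong₂ _+_ (sym den-σ) k+|Y|≡c ⟩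
    den σ + suc c                                                                           ∎
    where open ≡-Reasoning
          rearrange : ∀ a b c d e → a + b + (c + d) + e ≡ b + c + e + (a + d)
          rearrange = solve-∀

module ExcedancesKept {L : ℕ} {σ : List ℕ} (σ↭ : σ ↭ range 1 L) {c : ℕ} (c<s : suc c ≤ exc σ) where

  open Permutation σ↭

  s d e : ℕ
  s = exc σ
  d = (s + 1) ∸ suc c
  e = pivot σ (suc c)

  EXCL-σ : EXCL σ ≡ map σ[_] E
  EXCL-σ = cong (map σ[_]) Exc-σ

  sorted-EXCL : List ℕ
  sorted-EXCL = isort (EXCL σ)

  sorted-EXCL↭ : sorted-EXCL ↭ map σ[_] E
  sorted-EXCL↭ = subst (sorted-EXCL ↭_) EXCL-σ (isort-↭ (EXCL σ))

  sorted-EXCL↑ : AllPairs _<_ sorted-EXCL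
  sorted-EXCL↑ = isort-increasing (EXCL σ) (subst Unique (sym EXCL-σ) (map-σ[]-unique E↑ (All.tabulate (proj₁ ∘ ∈E⁻))))

  length-sorted-EXCL : length sorted-EXCL ≡ s
  length-sorted-EXCL = trans (↭-length (isort-↭ (EXCL σ))) (length-map σ[_] (Exc σ))

  d≡s∸c : d ≡ s ∸ c
  d≡s∸c = cong (_∸ suc c) (+-comm s 1)

  1≤d : 1 ≤ d
  1≤d = subst (1 ≤_) (sym d≡s∸c) (m<n⇒0<n∸m c<s)

  d≤s : d ≤ length sorted-EXCL
  d≤s = subst₂ _≤_ (sym d≡s∸c) (sym length-sorted-EXCL) (m∸n≤m s c)

  count-≥e : count (e ≤?_) (map σ[_] E) ≡ suc c
  count-≥e = begin
    count (e ≤?_) (map σ[_] E)        ≡⟨ count-↭ (e ≤?_) sorted-EXCL↭ ⟨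
    count (e ≤?_) sorted-EXCL         ≡⟨ count-≥-nth sorted-EXCL sorted-EXCL↑ 1≤d d≤s ⟩
    suc (length sorted-EXCL) ∸ d      ≡⟨ cong₂ (λ m n → suc m ∸ n) length-sorted-EXCL d≡s∸c ⟩
    suc s ∸ (s ∸ c)                   ≡⟨ +-∸-assoc 1 (m∸n≤m s c) ⟩
    suc (s ∸ (s ∸ c))                 ≡⟨ cong suc (m∸[m∸n]≡n (<⇒≤ c<s)) ⟩
    suc c                             ∎
    where open ≡-Reasoning

  private
    e∈σ[E] : e ∈ map σ[_] E
    e∈σ[E] = ∈-resp-↭ sorted-EXCL↭ (nth-∈ sorted-EXCL 1≤d d≤s)

  p₀ : ℕ
  p₀ = proj₁ (∈-map⁻ σ[_] e∈σ[E])

  p₀∈E : p₀ ∈ E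
  p₀∈E = proj₁ (proj₂ (∈-map⁻ σ[_] e∈σ[E]))

  e≡σ[p₀] : e ≡ σ[ p₀ ]
  e≡σ[p₀] = proj₂ (proj₂ (∈-map⁻ σ[_] e∈σ[E]))

  p₀<e : p₀ < e
  p₀<e = subst (p₀ <_) (sym e≡σ[p₀]) (proj₂ (∈E⁻ p₀∈E))

  e≤L : e ≤ L
  e≤L = subst (_≤ L) (sym e≡σ[p₀]) (proj₂ (∈R⁻ (σ[]∈R (proj₁ (∈E⁻ p₀∈E)))))

  open Threshold e (≤-trans (s≤s z≤n) p₀<e) (m≤n⇒m≤1+n e≤L)

  X⊆Lo : ∀ {i} → i ∈ X → i ∈ Lo
  X⊆Lo = proj₁ ∘ ∈-filter⁻ exc?

  Y⊆Hi : ∀ {i} → i ∈ Y → i ∈ Hi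
  Y⊆Hi = proj₁ ∘ ∈-filter⁻ exc?

  reaches? : Decidable (λ p → e ≤ σ[ p ])
  reaches? p = e ≤? σ[ p ]

  Q J : List ℕ
  Q = filter reaches? X
  J = chain σ e

  J≡ : J ≡ isort (map σ[_] Q)
  J≡ = cong (isort ∘ map σ[_]) (begin
    filterᵇ (λ p → (p <ᵇ e) ∧ (e ≤ᵇ nth σ p)) (Exc σ) ≡⟨ filterᵇ-does crosses? (Exc σ) ⟩
    filter crosses? (Exc σ)                            ≡⟨ cong (filter crosses?) (trans Exc-σ E-split) ⟩
    filter crosses? (X ++ Y)                           ≡⟨ filter-++ crosses? X Y ⟩
    filter crosses? X ++ filter crosses? Y             ≡⟨ cong₂ _++_ (filter-cong-local crosses? reaches? (λ p∈X → mk⇔ proj₂ (Lo-< (X⊆Lo p∈X) ,_)))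
                                                                     (filter-none crosses? (All.tabulate λ p∈Y (p<e , _) → <⇒≱ p<e (Hi-≥ (Y⊆Hi p∈Y)))) ⟩
    Q ++ []                                            ≡⟨ ++-identityʳ Q ⟩
    Q                                                  ∎)
    where
    open ≡-Reasoning
    crosses? : Decidable (λ p → p < e × e ≤ σ[ p ])
    crosses? p = (p <? e) ×-dec reaches? p

  J↭ : J ↭ map σ[_] Q
  J↭ = subst (_↭ map σ[_] Q) (sym J≡) (isort-↭ (map σ[_] Q))

  ∈Q⁻ : ∀ {p} → p ∈ Q → p ∈ X × e ≤ σ[ p ]
  ∈Q⁻ = ∈-filter⁻ reaches?

  J↑ : AllPairs _<_ J
  J↑ = subst (AllPairs _<_) (sym J≡)
             (isort-increasing (map σ[_] Q) (map-σ[]-unique Q↑ (All.tabulate (Lo⊆R ∘ X⊆Lo ∘ proj₁ ∘ ∈Q⁻))))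
    where Q↑ : AllPairs _<_ Q
          Q↑ = AllPairs.filter⁺ reaches? (AllPairs.filter⁺ exc? (range-increasing 1 (e ∸ 1)))

  ∈J⁻ : ∀ {v} → v ∈ J → ∃[ p ] p ∈ Q × v ≡ σ[ p ]
  ∈J⁻ v∈ = ∈-map⁻ σ[_] (∈-resp-↭ J↭ v∈)

  J-≥e : ∀ {v} → v ∈ J → e ≤ v
  J-≥e v∈ = let (p , p∈Q , v≡) = ∈J⁻ v∈ in subst (e ≤_) (sym v≡) (proj₂ (∈Q⁻ p∈Q))

  J++↑ : AllPairs _<_ (J ++ [ suc L ])
  J++↑ = AllPairs.++⁺ J↑ ([] ∷ []) (All.tabulate λ v∈ → let (p , p∈Q , v≡) = ∈J⁻ v∈ in
           subst (_< suc L) (sym v≡) (σ[]<L+1 (Lo⊆R (X⊆Lo (proj₁ (∈Q⁻ p∈Q))))) ∷ [])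

  e∈J : e ∈ J
  e∈J = ∈-resp-↭ (↭-sym J↭)
          (subst (_∈ map σ[_] Q) (sym e≡σ[p₀]) (∈-map⁺ σ[_] (∈-filter⁺ reaches? p₀∈X (≤-reflexive e≡σ[p₀]))))
    where p₀∈X : p₀ ∈ X
          p₀∈X with ∈-++⁻ X (subst (p₀ ∈_) E-split p₀∈E)
          ... | inj₁ p₀∈X = p₀∈X
          ... | inj₂ p₀∈Y = contradiction (Hi-≥ (Y⊆Hi p₀∈Y)) (<⇒≱ p₀<e)

  Y-letters∉J : ∀ {i} → i ∈ Y → σ[ i ] ∉ J
  Y-letters∉J {i} i∈Y σi∈J = let (p , p∈Q , σi≡σp) = ∈J⁻ σi∈J ; p∈Lo = X⊆Lo (proj₁ (∈Q⁻ p∈Q)) in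
    contradiction (subst (_< e) (sym (σ[]-injective (Hi⊆R (Y⊆Hi i∈Y)) (Lo⊆R p∈Lo) σi≡σp)) (Lo-< p∈Lo))
                  (≤⇒≯ (Hi-≥ (Y⊆Hi i∈Y)))

  g : ℕ → ℕ
  g = nextIn (J ++ [ suc L ])

  g-below-e : ∀ {v} → v < e → g v ≡ v
  g-below-e v<e = nextIn-∉ J (suc L) (λ v∈ → <⇒≱ v<e (J-≥e v∈))

  g-≥ : ∀ v → v ≤ g v
  g-≥ v with v ∈? J
  ... | yes v∈ = <⇒≤ (nextIn-increasing (suc L) J J++↑ v∈)
  ... | no  v∉ = ≤-reflexive (sym (nextIn-∉ J (suc L) v∉))

  g-monotone : ∀ {x y} → x ∈ J ⊎ x < e → y ∈ J ⊎ y < e → x < y → g x < g y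
  g-monotone (inj₁ x∈) (inj₁ y∈) x<y = nextIn-monotone (suc L) J J++↑ x∈ y∈ x<y
  g-monotone (inj₁ x∈) (inj₂ y<e) x<y = contradiction (<-trans x<y y<e) (≤⇒≯ (J-≥e x∈))
  g-monotone (inj₂ x<e) (inj₁ y∈) x<y = subst (_< g _) (sym (g-below-e x<e)) (<-trans x<y (nextIn-increasing (suc L) J J++↑ y∈))
  g-monotone (inj₂ x<e) (inj₂ y<e) x<y = subst₂ _<_ (sym (g-below-e x<e)) (sym (g-below-e y<e)) x<y

  w₀ : List ℕ
  w₀ = map g σ ++ [ suc L ]

  length-w₀ : length w₀ ≡ suc L
  length-w₀ = trans (length-++ (map g σ)) (trans (+-comm _ 1) (cong suc (trans (length-map g σ) length-σ)))

  nth-w₀ : ∀ {i} → i ∈ R → nth w₀ i ≡ g σ[ i ]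
  nth-w₀ {i} i∈ = let (1≤i , i≤) = ∈R⇒index i∈ in
    trans (nth-++ˡ (map g σ) [ suc L ] (subst (i ≤_) (sym (length-map g σ)) i≤)) (nth-map g σ 1≤i i≤)

  B↑ : AllPairs _<_ B
  B↑ = AllPairs.filter⁺ (∁? exc?) (range-increasing e (suc L ∸ e))

  B⊆Hi : ∀ {i} → i ∈ B → i ∈ Hi
  B⊆Hi = proj₁ ∘ ∈-filter⁻ (∁? exc?)

  B-nonExc : All (λ q → σ[ q ] ≤ q) B
  B-nonExc = All.tabulate (≮⇒≥ ∘ proj₂ ∘ ∈-filter⁻ (∁? exc?) {xs = Hi})

  open ShiftAlong σ w₀ length-w₀ B↑ (All.tabulate (Hi⊆R ∘ B⊆Hi)) e

  w : List ℕ
  w = shiftAlong σ path e w₀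

  path-≥e : All (e ≤_) path
  path-≥e = All.++⁺ (All.tabulate (Hi-≥ ∘ B⊆Hi)) (m≤n⇒m≤1+n e≤L ∷ [])

  phiDen≡w : phiDen (suc L) σ (suc c) ≡ w
  phiDen≡w = trans (phiDen-≤exc L σ c c<s) (cong (λ ks → shiftAlong σ ks e w₀) suffix)
    where
    open ≡-Reasoning
    suffix : dropWhileᵇ (λ k → k <ᵇ e) (NonExc σ ++ [ suc L ]) ≡ path
    suffix = begin
      dropWhileᵇ (λ k → k <ᵇ e) (NonExc σ ++ [ suc L ]) ≡⟨ dropWhileᵇ-does (_<? e) (NonExc σ ++ [ suc L ]) ⟩
      dropWhile (_<? e) (NonExc σ ++ [ suc L ])
        ≡⟨ cong (λ xs → dropWhile (_<? e) (xs ++ [ suc L ])) (trans NonExc-σ NE-split) ⟩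
      dropWhile (_<? e) ((A ++ B) ++ [ suc L ])         ≡⟨ cong (dropWhile (_<? e)) (++-assoc A B [ suc L ]) ⟩
      dropWhile (_<? e) (A ++ path)
        ≡⟨ dropWhile-++ (_<? e) path (All.tabulate (Lo-< ∘ proj₁ ∘ ∈-filter⁻ (∁? exc?))) ⟩
      dropWhile (_<? e) path                            ≡⟨ dropWhile-none (_<? e) (All.map ≤⇒≯ path-≥e) ⟩
      path                                              ∎

  length-w : length w ≡ suc L
  length-w = trans (length-applyUpdates ((nth path 1 , e) ∷ shiftUpdates σ path) w₀) length-w₀

  path-≤ : All (λ q → nth w q ≤ q) path
  path-≤ = shift-nonExcedances σ[_] (nth w) B (suc L) e path↑ B-nonExc path-≥e map-nth-shiftAlong

  w-off-path : ∀ {i} → i ∈ R → i ∉ path → nth w i ≡ g σ[ i ]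
  w-off-path i∈ i∉ = trans (nth-shiftAlong-∉ i∉) (nth-w₀ i∈)

  path-nonExc : ∀ {i} → i ∈ R → i ∈ path → σ[ i ] ≤ i
  path-nonExc i∈R i∈ with ∈-++⁻ B i∈
  ... | inj₁ i∈B         = All.lookup B-nonExc i∈B
  ... | inj₂ (here refl) = contradiction (proj₂ (∈R⁻ i∈R)) (<⇒≱ ≤-refl)

  nonExc-off-path : ∀ {i} → i ∈ R → σ[ i ] ≤ i → i ∉ path → i < e
  nonExc-off-path {i} i∈R σi≤i i∉ with ∈-++⁻ A (subst (i ∈_) NE-split (∈-filter⁺ (∁? exc?) i∈R (≤⇒≯ σi≤i)))
  ... | inj₁ i∈A = Lo-< (proj₁ (∈-filter⁻ (∁? exc?) i∈A))
  ... | inj₂ i∈B = contradiction (∈-++⁺ˡ i∈B) i∉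

  excedance-w : ∀ {i} → i ∈ R → i < nth w i ⇔ i < σ[ i ]
  excedance-w {i} i∈R with i ∈? path
  ... | yes i∈ = mk⇔ (λ i<wi → contradiction (All.lookup path-≤ i∈) (<⇒≱ i<wi))
                     (λ i<σi → contradiction (path-nonExc i∈R i∈) (<⇒≱ i<σi))
  ... | no i∉ rewrite w-off-path i∈R i∉ = mk⇔ to (λ i<σi → <-≤-trans i<σi (g-≥ σ[ i ]))
    where
    to : i < g σ[ i ] → i < σ[ i ]
    to i<gσi with exc? i
    ... | yes i<σi = i<σi
    ... | no  i≮σi = let σi≤i = ≮⇒≥ i≮σi in
      contradiction (subst (i <_) (g-below-e (≤-<-trans σi≤i (nonExc-off-path i∈R σi≤i i∉))) i<gσi) (≤⇒≯ σi≤i)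

  w[L+1]≤ : nth w (suc L) ≤ suc L
  w[L+1]≤ = All.lookup path-≤ (∈-++⁺ʳ B (here refl))

  Exc-w : Exc w ≡ E
  Exc-w = proj₁ (Exc-extension L w exc? length-w excedance-w w[L+1]≤)

  NonExc-w : NonExc w ≡ NE ++ [ suc L ]
  NonExc-w = proj₂ (Exc-extension L w exc? length-w excedance-w w[L+1]≤)

  Exc-phiDen : ∀ i → i ∈ Exc (phiDen (suc L) σ (suc c)) ⇔ i ∈ Exc σ
  Exc-phiDen i = mk⇔ (subst (i ∈_) Exc-phiDen≡) (subst (i ∈_) (sym Exc-phiDen≡))
    where Exc-phiDen≡ : Exc (phiDen (suc L) σ (suc c)) ≡ Exc σ
          Exc-phiDen≡ = trans (cong Exc phiDen≡w) (trans Exc-w (sym Exc-σ))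

  w-on-E : ∀ {i} → i ∈ E → nth w i ≡ g σ[ i ]
  w-on-E i∈E = let (i∈R , i<σi) = ∈E⁻ i∈E in
    w-off-path i∈R (λ i∈path → contradiction (path-nonExc i∈R i∈path) (<⇒≱ i<σi))

  w-on-A : ∀ {i} → i ∈ A → nth w i ≡ σ[ i ]
  w-on-A i∈A = let (i∈Lo , i≮σi) = ∈-filter⁻ (∁? exc?) i∈A ; i<e = Lo-< i∈Lo in
    trans (w-off-path (Lo⊆R i∈Lo) (λ i∈path → <⇒≱ i<e (All.lookup path-≥e i∈path)))
          (g-below-e (≤-<-trans (≮⇒≥ i≮σi) i<e))

  EXCL-w : map (nth w) E ≡ map g (map σ[_] X) ++ map σ[_] Y
  EXCL-w = begin
    map (nth w) E                       ≡⟨ cong (map (nth w)) E-split ⟩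
    map (nth w) (X ++ Y)                ≡⟨ map-++ (nth w) X Y ⟩
    map (nth w) X ++ map (nth w) Y      ≡⟨ cong₂ _++_ (trans (map-cong-local (All.tabulate (w-on-E ∘ X⊆E))) (map-∘ X))
                                                      (map-cong-local (All.tabulate λ i∈Y →
                                                         trans (w-on-E (Y⊆E i∈Y)) (nextIn-∉ J (suc L) (Y-letters∉J i∈Y)))) ⟩
    map g (map σ[_] X) ++ map σ[_] Y    ∎
    where open ≡-Reasoning

  X-letters-in-domain : ∀ {u} → u ∈ map σ[_] X → u ∈ J ⊎ u < e
  X-letters-in-domain u∈ with ∈-map⁻ σ[_] u∈
  ... | p , p∈X , refl with reaches? p
  ...   | yes e≤σp = inj₁ (∈-resp-↭ (↭-sym J↭) (∈-map⁺ σ[_] (∈-filter⁺ reaches? p∈X e≤σp)))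
  ...   | no  e≰σp = inj₂ (≰⇒> e≰σp)

  count-above-relabelled : ∀ {v} → e ≤ v → v < suc L → count (v <?_) (map g (map σ[_] X)) ≡ suc (count (v <?_) (map σ[_] X))
  count-above-relabelled {v} e≤v v<L+1 = begin
    count (v <?_) (map g P)                                ≡⟨ count-map (v <?_) g P ⟩
    count (λ u → v <? g u) P                               ≡⟨ count-partition (λ u → v <? g u) (e ≤?_) P ⟩
    count (λ u → v <? g u) high + count (λ u → v <? g u) low
      ≡⟨ cong₂ _+_ (trans (cong (count (λ u → v <? g u)) high≡) on-chain)
                   (count-cong-local (λ u → v <? g u) (v <?_) fixed-low) ⟩
    suc (count (v <?_) (map σ[_] Q)) + count (v <?_) low
      ≡⟨ cong (λ xs → suc (count (v <?_) xs + count (v <?_) low)) high≡ ⟨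
    suc (count (v <?_) high + count (v <?_) low)           ≡⟨ cong suc (count-partition (v <?_) (e ≤?_) P) ⟨
    suc (count (v <?_) P)                                  ∎
    where
    open ≡-Reasoning
    P high low : List ℕ
    P    = map σ[_] X
    high = filter (e ≤?_) P
    low  = filter (∁? (e ≤?_)) P

    high≡ : high ≡ map σ[_] Q
    high≡ = filter-map (e ≤?_) σ[_] X

    on-chain : count (λ u → v <? g u) (map σ[_] Q) ≡ suc (count (v <?_) (map σ[_] Q))
    on-chain = begin
      count (λ u → v <? g u) (map σ[_] Q) ≡⟨ count-↭ (λ u → v <? g u) J↭ ⟨
      count (λ u → v <? g u) J            ≡⟨ count-map (v <?_) g J ⟨
      count (v <?_) (map g J)             ≡⟨ count-map-nextIn (suc L) J J++↑ e∈J e≤v v<L+1 ⟩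
      suc (count (v <?_) J)               ≡⟨ cong suc (count-↭ (v <?_) J↭) ⟩
      suc (count (v <?_) (map σ[_] Q))    ∎

    fixed-low : ∀ {u} → u ∈ low → v < g u ⇔ v < u
    fixed-low {u} u∈ = let g-u≡u = g-below-e (≰⇒> (proj₂ (∈-filter⁻ (∁? (e ≤?_)) {xs = P} u∈))) in
      mk⇔ (subst (v <_) g-u≡u) (subst (v <_) (sym g-u≡u))

  Y-letters-above : ∀ {v} → v ∈ map σ[_] Y → e ≤ v × v < suc L
  Y-letters-above v∈ with ∈-map⁻ σ[_] v∈
  ... | i , i∈Y , refl = let (i∈R , i<σi) = ∈E⁻ (Y⊆E i∈Y) in
    ≤-trans (Hi-≥ (Y⊆Hi i∈Y)) (<⇒≤ i<σi) , σ[]<L+1 i∈R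

  inv-EXCL-w : inv (map (nth w) E) ≡ inv (map σ[_] E) + length Y
  inv-EXCL-w = begin
    inv (map (nth w) E)                                                ≡⟨ cong inv EXCL-w ⟩
    inv (map g P ++ σY)                                                ≡⟨ inv-++ (map g P) σY ⟩
    inv (map g P) + inv σY + cross (map g P) σY
      ≡⟨ cong₂ _+_ (cong (_+ inv σY) (inv-map-monotone g P λ x∈ y∈ → g-monotone (X-letters-in-domain x∈) (X-letters-in-domain y∈)))
                   cross-relabelled ⟩
    inv P + inv σY + (cross P σY + length σY)                          ≡⟨ +-assoc (inv P + inv σY) (cross P σY) (length σY) ⟨
    inv P + inv σY + cross P σY + length σY                            ≡⟨ cong₂ _+_ (sym (inv-++ P σY)) (length-map σ[_] Y) ⟩
    inv (P ++ σY) + length Y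
      ≡⟨ cong (λ xs → inv xs + length Y) (trans (sym (map-++ σ[_] X Y)) (cong (map σ[_]) (sym E-split))) ⟩
    inv (map σ[_] E) + length Y                                        ∎
    where
    open ≡-Reasoning
    P σY : List ℕ
    P  = map σ[_] X
    σY = map σ[_] Y
    cross-relabelled : cross (map g P) σY ≡ cross P σY + length σY
    cross-relabelled = trans (cong sum (map-cong-local (All.tabulate λ v∈ → let (e≤v , v<) = Y-letters-above v∈ in
                                                                             count-above-relabelled e≤v v<)))
                             (sum-map-suc (λ v → count (v <?_) P) σY)

  inv-NEXCL-w : inv (map (nth w) (NE ++ [ suc L ])) ≡ inv (map σ[_] NE) + count reaches? X
  inv-NEXCL-w = begin
    inv (map (nth w) (NE ++ [ suc L ]))
      ≡⟨ cong (inv ∘ map (nth w)) (trans (cong (_++ [ suc L ]) NE-split) (++-assoc A B [ suc L ])) ⟩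
    inv (map (nth w) (A ++ path))
      ≡⟨ cong inv (trans (map-++ (nth w) A path) (cong₂ _++_ (map-cong-local (All.tabulate w-on-A)) map-nth-shiftAlong)) ⟩
    inv (map σ[_] A ++ e ∷ map σ[_] B)
      ≡⟨ inv-insert (map σ[_] A) e (map σ[_] B) ⟩
    inv (map σ[_] A ++ map σ[_] B) + count (e <?_) (map σ[_] A) + count (_<? e) (map σ[_] B)
      ≡⟨ cong₂ (λ xs n → inv xs + n + count (_<? e) (map σ[_] B))
               (trans (sym (map-++ σ[_] A B)) (cong (map σ[_]) (sym NE-split)))
               (count-none (e <?_) (All.map⁺ (All.tabulate (<⇒≯ ∘ A-letters-below)))) ⟩
    inv (map σ[_] NE) + 0 + count (_<? e) (map σ[_] B)
      ≡⟨ cong₂ _+_ (+-identityʳ _) B-letters-below ⟩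
    inv (map σ[_] NE) + count reaches? X ∎
    where
    open ≡-Reasoning
    A-letters-below : ∀ {i} → i ∈ A → σ[ i ] < e
    A-letters-below i∈A = let (i∈Lo , i≮σi) = ∈-filter⁻ (∁? exc?) i∈A in ≤-<-trans (≮⇒≥ i≮σi) (Lo-< i∈Lo)

    below? : Decidable (λ i → σ[ i ] < e)
    below? i = σ[ i ] <? e

    B-letters-below : count (_<? e) (map σ[_] B) ≡ count reaches? X
    B-letters-below = begin
      count (_<? e) (map σ[_] B)                     ≡⟨ count-map (_<? e) σ[_] B ⟩
      count below? B
        ≡⟨ cong (_+ count below? B)
                (count-none below? (All.tabulate λ i∈Y → ≤⇒≯ (proj₁ (Y-letters-above (∈-map⁺ σ[_] i∈Y))))) ⟨
      count below? Y + count below? B                ≡⟨ count-partition below? exc? Hi ⟨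
      count below? Hi                                ≡⟨ crossings-balance ⟩
      count reaches? Lo                              ≡⟨ count-partition reaches? exc? Lo ⟩
      count reaches? X + count reaches? A
        ≡⟨ cong (count reaches? X +_) (count-none reaches? (All.tabulate (<⇒≱ ∘ A-letters-below))) ⟩
      count reaches? X + 0                           ≡⟨ +-identityʳ _ ⟩
      count reaches? X                               ∎

  |Y|+reaching≡c : length Y + count reaches? X ≡ suc c
  |Y|+reaching≡c = begin
    length Y + count reaches? X
      ≡⟨ cong (_+ count reaches? X) (count-all reaches? (All.tabulate (proj₁ ∘ Y-letters-above ∘ ∈-map⁺ σ[_]))) ⟨
    count reaches? Y + count reaches? X       ≡⟨ +-comm (count reaches? Y) _ ⟩
    count reaches? X + count reaches? Y       ≡⟨ count-++ reaches? X Y ⟨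
    count reaches? (X ++ Y)                   ≡⟨ cong (count reaches?) E-split ⟨
    count reaches? E                          ≡⟨ count-map (e ≤?_) σ[_] E ⟨
    count (e ≤?_) (map σ[_] E)                ≡⟨ count-≥e ⟩
    suc c                                     ∎
    where open ≡-Reasoning

  den-phiDen : den (phiDen (suc L) σ (suc c)) ≡ den σ + suc c
  den-phiDen = begin
    den (phiDen (suc L) σ (suc c))                                                   ≡⟨ cong den phiDen≡w ⟩
    den w                                                                            ≡⟨ den-via-Exc w Exc-w NonExc-w ⟩
    sum E + inv (map (nth w) E) + inv (map (nth w) (NE ++ [ suc L ]))
      ≡⟨ cong₂ (λ m n → sum E + m + n) inv-EXCL-w inv-NEXCL-w ⟩
    sum E + (inv (map σ[_] E) + length Y) + (inv (map σ[_] NE) + count reaches? X)  ≡⟨ rearrange (sum E) _ (length Y) _ _ ⟩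
    sum E + inv (map σ[_] E) + inv (map σ[_] NE) + (length Y + count reaches? X)
      ≡⟨ cong₂ _+_ (sym den-σ) |Y|+reaching≡c ⟩
    den σ + suc c                                                                    ∎
    where open ≡-Reasoning
          rearrange : ∀ a b c d e → a + (b + c) + (d + e) ≡ a + b + d + (c + e)
          rearrange = solve-∀

lemma2p2 : (n : ℕ) → 1 ≤ n → (σ : List ℕ) → IsPerm (n ∸ 1) σ → (c : ℕ) → c ≤ n ∸ 1 →
    ((c ≤ exc σ → ∀ i → (i ∈ Exc (phiDen n σ c) ⇔ i ∈ Exc σ))
    × (exc σ < c → ∀ i → (i ∈ Exc (phiDen n σ c) ⇔ (i ∈ Exc σ ⊎ i ≡ nth (NonExc σ) (c ∸ exc σ)))))
    × den (phiDen n σ c) ≡ den σ + c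
lemma2p2 (suc L) _ σ σ↭positions zero _ =
  ((λ _ i → mk⇔ (subst (i ∈_) Exc≡) (subst (i ∈_) (sym Exc≡))) , λ ()) , trans den-appended (sym (+-identityʳ (den σ)))
  where
  open Permutation (subst (σ ↭_) (positions≡range L) σ↭positions)
  Exc≡ : Exc (σ ++ [ suc L ]) ≡ Exc σ
  Exc≡ = trans Exc-appended (sym Exc-σ)
lemma2p2 (suc L) _ σ σ↭positions (suc c) c≤L with suc c ≤? exc σ
... | yes c≤s = ((λ _ → Exc-phiDen) , λ s<c → contradiction c≤s (<⇒≱ s<c)) , den-phiDen
  where open ExcedancesKept (subst (σ ↭_) (positions≡range L) σ↭positions) c≤s
... | no  c≰s = ((λ c≤s → contradiction c≤s c≰s) , λ _ → Exc-phiDen) , den-phiDen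
  where open ExcedanceAdded (subst (σ ↭_) (positions≡range L) σ↭positions) (≰⇒> c≰s) c≤L
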